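{- Let $(\circ,\overline{\circ})$ be either $(*,\overline{*})$ or $(\sqcup\!\!\sqcup,\overline{\sqcup\!\!\sqcup})$. For every integer $m\ge0$ and every word $w\in\mathfrak{H}^0$, there exist unique $w_0,w_1,\ldots,w_m\in\mathfrak{H}^0$ such that \[ y^mw=w_0+w_1\,\overline{\circ}\,y+w_2\,\overline{\circ}\,y^{\overline{\circ}2}+\cdots+w_m\,\overline{\circ}\,y^{\overline{\circ}m}; \] that is, $\mathfrak{H}^1_{\overline{\circ}}\cong\mathfrak{H}^0_{\overline{\circ}}[y]$ (the $\mathfrak{H}^0_{\overline{\circ}}$-algebra homomorphism from the polynomial ring $\mathfrak{H}^0_{\overline{\circ}}[T]$ to $\mathfrak{H}^1_{\overline{\circ}}$ sending $T$ to $y$ is an isomorphism).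
   Context: Let $\mathfrak{H}=\mathbb{Q}\langle x,y\rangle$ be the noncommutative polynomial ring in $x,y$, $\mathfrak{H}^1=\mathbb{Q}+\mathfrak{H}y$, $\mathfrak{H}^0=\mathbb{Q}+x\mathfrak{H}y$, and $z_k=x^{k-1}y$ ($k\ge1$). $y^m w$ denotes concatenation. The n-harmonic product $\overline{*}$ on $\mathfrak{H}^1$ is the $\mathbb{Q}$-bilinear product defined inductively by $1\,\overline{*}\,w=w\,\overline{*}\,1=w$ and $z_kw_1\,\overline{*}\,z_lw_2=z_k(w_1\,\overline{*}\,z_lw_2)+z_l(z_kw_1\,\overline{*}\,w_2)-z_{k+l}(w_1\,\overline{*}\,w_2)$ for words $w,w_1,w_2\in\mathfrak{H}^1$; the harmonic product $*$ is defined the same way with $+z_{k+l}(w_1*w_2)$ instead. The n-shuffle product $\overline{\sqcup\!\!\sqcup}$ on $\mathfrak{H}$ is the $\mathbb{Q}$-bilinear product defined inductively by $1\,\overline{\sqcup\!\!\sqcup}\,w=w\,\overline{\sqcup\!\!\sqcup}\,1=w$ and $u_1w_1\,\overline{\sqcup\!\!\sqcup}\,u_2w_2=u_1(w_1\,\overline{\sqcup\!\!\sqcup}\,u_2w_2)+u_2(u_1w_1\,\overline{\sqcup\!\!\sqcup}\,w_2)-\delta(w_1)\tau(u_1)u_2w_2-\delta(w_2)\tau(u_2)u_1w_1$ for $u_1,u_2\in\{x,y\}$ and words $w,w_1,w_2\in\mathfrak{H}$, where $\delta(w)=1$ if $w=1$ and $0$ otherwise, $\tau(x)=y$, $\tau(y)=x$;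 the shuffle product $\sqcup\!\!\sqcup$ is defined the same way without the two $\delta$-terms. These products are commutative and associative; $\mathfrak{H}^1_{\overline{\circ}}$ denotes $\mathfrak{H}^1$ with product $\overline{\circ}$ and $\mathfrak{H}^0_{\overline{\circ}}$ its subalgebra $\mathfrak{H}^0$. $y^{\overline{\circ}i}$ is the $i$-th power of $y$ with respect to $\overline{\circ}$ ($y^{\overline{\circ}0}=1$). -}

module Defs where

open import Data.Nat using (ℕ; zero; suc; _+_)
open import Data.List using (List; []; _∷_; _++_; map; concatMap; replicate)
open import Data.List.Properties using (≡-dec)
open import Data.Vec using (Vec; []; _∷_; lookup)
open import Data.Fin using (Fin)
open import Data.Product using (_×_; _,_; Σ; ∃)
open import Data.Rational using (ℚ; 0ℚ; 1ℚ; -_) renaming (_+_ to _+ℚ_; _*_ to _*ℚ_)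
open import Relation.Binary.PropositionalEquality using (_≡_; _≢_)
open import Relation.Nullary using (yes; no; Dec)
open import Relation.Binary using (DecidableEquality)

data Letter : Set where
  x y : Letter

_≟L_ : DecidableEquality Letter
x ≟L x = yes Relation.Binary.PropositionalEquality.refl
x ≟L y = no λ ()
y ≟L x = no λ ()
y ≟L y = yes Relation.Binary.PropositionalEquality.refl

Word : Set
Word = List Letter

_≟W_ : DecidableEquality Word
_≟W_ = ≡-dec _≟L_

-- Noncommutative polynomials: finite formal ℚ-linear combinations of
-- words, compared via their coefficient functions.

Poly : Set
Poly = List (ℚ × Word)

coeff : Poly → Word → ℚ
coeff [] u = 0ℚ
coeff ((c , v) ∷ p) u with v ≟W u
... | yes _ = c +ℚ coeff p u
... | no  _ = coeff p u

infix 4 _≈_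
_≈_ : Poly → Poly → Set
p ≈ q = ∀ u → coeff p u ≡ coeff q u

word : Word → Poly
word w = (1ℚ , w) ∷ []

one : Poly
one = word []

infixl 6 _⊕_ _⊖_
_⊕_ : Poly → Poly → Poly
p ⊕ q = p ++ q

neg : Poly → Poly
neg = map (λ { (c , v) → (- c , v) })

_⊖_ : Poly → Poly → Poly
p ⊖ q = p ++ neg q

prefix : Word → Poly → Poly
prefix u = map (λ { (c , v) → (c , u ++ v) })

scale : ℚ → Poly → Poly
scale a = map (λ { (c , v) → (a *ℚ c , v) })

data IsH0Word : Word → Set where
  empty : IsH0Word []
  xy    : ∀ u → IsH0Word (x ∷ (u ++ (y ∷ [])))

InH0 : Poly → Set
InH0 p = ∀ u → coeff p u ≢ 0ℚ → IsH0Word u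

-- n-harmonic product.  A word of 𝔥¹ is z_{k₁}⋯z_{kₙ}; we encode z_k
-- by the natural number k-1.

toZ : Word → List ℕ
toZ [] = []
toZ (y ∷ w) = 0 ∷ toZ w
toZ (x ∷ w) with toZ w
... | []     = []          -- only reached for words not in 𝔥¹
... | k ∷ ks = suc k ∷ ks

fromZ : List ℕ → Word
fromZ [] = []
fromZ (k ∷ ks) = replicate k x ++ (y ∷ fromZ ks)

ZPoly : Set
ZPoly = List (ℚ × List ℕ)

zcons : ℕ → ZPoly → ZPoly
zcons k = map (λ { (c , v) → (c , k ∷ v) })

zneg : ZPoly → ZPoly
zneg = map (λ { (c , v) → (- c , v) })

-- z_k w₁ ⊛̄ z_l w₂ = z_k(w₁ ⊛̄ z_l w₂) + z_l(z_k w₁ ⊛̄ w₂) - z_{k+l}(w₁ ⊛̄ w₂)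
-- (indices shifted: (k-1)+(l-1)+1 = (k+l)-1)
nharmZ : List ℕ → List ℕ → ZPoly
nharmZ [] v = (1ℚ , v) ∷ []
nharmZ (a ∷ u) [] = (1ℚ , a ∷ u) ∷ []
nharmZ (a ∷ u) (b ∷ v) =
  zcons a (nharmZ u (b ∷ v)) ++ zcons b (nharmZ (a ∷ u) v)
  ++ zneg (zcons (suc (a + b)) (nharmZ u v))

fromZPoly : ZPoly → Poly
fromZPoly = map (λ { (c , v) → (c , fromZ v) })

-- n-harmonic product of two words (meaningful for words of 𝔥¹)
nharm : Word → Word → Poly
nharm u v = fromZPoly (nharmZ (toZ u) (toZ v))

τ : Letter → Letter
τ x = y
τ y = x

δ : Word → ℚ
δ [] = 1ℚ
δ (_ ∷ _) = 0ℚ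

nshuf : Word → Word → Poly
nshuf [] w = word w
nshuf (u ∷ w) [] = word (u ∷ w)
nshuf (u₁ ∷ w₁) (u₂ ∷ w₂) =
  prefix (u₁ ∷ []) (nshuf w₁ (u₂ ∷ w₂))
  ⊕ prefix (u₂ ∷ []) (nshuf (u₁ ∷ w₁) w₂)
  ⊖ (scale (δ w₁) (word (τ u₁ ∷ u₂ ∷ w₂))
     ⊕ scale (δ w₂) (word (τ u₂ ∷ u₁ ∷ w₁)))

-- The two choices (∘,∘̄) = (*,*̄) or (ш,ш̄); we only need ∘̄.

data Choice : Set where
  harmonic shuffle : Choice

wordProd : Choice → Word → Word → Poly
wordProd harmonic = nharm
wordProd shuffle  = nshuf

mul : Choice → Poly → Poly → Poly
mul ch p q = concatMap (λ { (c , u) →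
               concatMap (λ { (d , v) → scale (c *ℚ d) (wordProd ch u v) }) q }) p

ypow : Choice → ℕ → Poly
ypow ch zero = one
ypow ch (suc i) = mul ch (ypow ch i) (word (y ∷ []))

linComb : Choice → ∀ {n} → Vec Poly n → ℕ → Poly
linComb ch [] i = []
linComb ch (p ∷ ps) i = mul ch p (ypow ch i) ⊕ linComb ch ps (suc i)

expansion : Choice → ∀ {n} → Vec Poly n → Poly
expansion ch ws = linComb ch ws 0

AllH0 : ∀ {n} → Vec Poly n → Set
AllH0 ws = ∀ i → InH0 (lookup ws i)

module Submission where

-- Every word of 𝔥¹ ∪ {1} is y^j h with h ∈ 𝔥⁰; j is its height.  The proof
-- only uses three triangularity facts about ∘̄ on words (record Triangular):
-- a ∘̄ y = (j+1)·ya + lower terms (a of height j), h ∘̄ y^j = y^j h + lower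
-- terms, and h ∘̄ b has height ≤ height b.  Hence h ∘̄ y^{∘̄ i} = i!·y^i h +
-- (height < i), so expanding is triangular with invertible diagonal i!:
-- existence by induction on the height, solving for the top word; uniqueness
-- by reading the last coefficient w_k at the words y^k u (u ∈ 𝔥⁰).

open import Defs
open import Data.Nat using (ℕ; suc)
open import Data.List using (replicate; _++_)
open import Data.Vec using (Vec; lookup)
open import Data.Fin using (Fin)
open import Data.Product using (Σ; _×_)

open import Data.Nat as N using (zero; z≤n; s≤s)
import Data.Nat.Properties as ℕP
open import Data.List using (List; []; _∷_; length)
open import Data.List.Properties using (++-assoc; ++-identityʳ; ++-cancelˡ; ∷-injectiveˡ; ∷-injectiveʳ; ≡-dec)
open import Data.List.Relation.Unary.All as All using (All; []; _∷_)
open import Data.Vec as V using ([]; _∷_; _∷ʳ_; zipWith)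
import Data.Vec.Properties as VP
open import Data.Fin using (zero; suc)
open import Data.Product using (_,_; proj₁; proj₂)
open import Data.Sum using (_⊎_; inj₁; inj₂)
open import Data.Empty using (⊥-elim)
open import Data.Rational using (ℚ; 0ℚ; 1ℚ; -_; _+_; _*_; NonZero; NonNegative; Positive; ≢-nonZero; 1/_)
import Data.Rational.Properties as ℚP
open import Data.Rational.Solver using (module +-*-Solver)
open import Algebra.Properties.Group ℚP.+-0-group using (x∙y⁻¹≈ε⇒x≈y)
open import Relation.Binary.PropositionalEquality
open import Relation.Nullary using (yes; no; Dec; ¬_)

open +-*-Solver using (solve; _:=_; _:+_; _:*_; :-_; con)
open ≡-Reasoning

-- The rationals n = 1 + ⋯ + 1 and n! ; they are nonzero for n ≥ 1, which is
-- what makes the leading coefficients of the expansion invertible.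

natℚ : ℕ → ℚ
natℚ zero = 0ℚ
natℚ (suc n) = 1ℚ + natℚ n

factℚ : ℕ → ℚ
factℚ zero = 1ℚ
factℚ (suc n) = natℚ (suc n) * factℚ n

natℚ-nonNeg : ∀ n → NonNegative (natℚ n)
natℚ-nonNeg zero = _
natℚ-nonNeg (suc n) = ℚP.nonNeg+nonNeg⇒nonNeg 1ℚ (natℚ n) {{natℚ-nonNeg n}}

natℚ-suc≢0 : ∀ n → natℚ (suc n) ≢ 0ℚ
natℚ-suc≢0 n eq = ℚP.<-irrefl (sym eq) (ℚP.positive⁻¹ (natℚ (suc n)) {{pos}})
  where
  pos : Positive (natℚ (suc n))
  pos = ℚP.pos+nonNeg⇒pos 1ℚ (natℚ n) {{natℚ-nonNeg n}}

*-zero-cancelˡ : ∀ a b → a * b ≡ 0ℚ → a ≢ 0ℚ → b ≡ 0ℚ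
*-zero-cancelˡ a b ab≡0 a≢0 = begin
  b                  ≡⟨ sym (ℚP.*-identityˡ b) ⟩
  1ℚ * b             ≡⟨ cong (_* b) (sym (ℚP.*-inverseˡ a)) ⟩
  (a⁻¹ * a) * b      ≡⟨ ℚP.*-assoc a⁻¹ a b ⟩
  a⁻¹ * (a * b)      ≡⟨ cong (a⁻¹ *_) ab≡0 ⟩
  a⁻¹ * 0ℚ           ≡⟨ ℚP.*-zeroʳ a⁻¹ ⟩
  0ℚ                 ∎
  where
  instance
    a≠0 : NonZero a
    a≠0 = ≢-nonZero a≢0
  a⁻¹ : ℚ
  a⁻¹ = 1/ a

factℚ≢0 : ∀ n → factℚ n ≢ 0ℚ
factℚ≢0 zero ()
factℚ≢0 (suc n) eq =
  factℚ≢0 n (*-zero-cancelˡ (natℚ (suc n)) (factℚ n) eq (natℚ-suc≢0 n))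

difference-zero : ∀ a b → a + - b ≡ 0ℚ → a ≡ b
difference-zero = x∙y⁻¹≈ε⇒x≈y

-- Coefficients are pairings with indicator functions,
-- and the bilinear product is a double pairing, so pairings carry all of
-- the linear algebra below.

pairing : (Word → ℚ) → Poly → ℚ
pairing g [] = 0ℚ
pairing g ((c , v) ∷ p) = c * g v + pairing g p

indicator : Word → Word → ℚ
indicator t u with u ≟W t
... | yes _ = 1ℚ
... | no _ = 0ℚ

indicator-≡ : ∀ t → indicator t t ≡ 1ℚ
indicator-≡ t with t ≟W t
... | yes _ = refl
... | no t≢t = ⊥-elim (t≢t refl)

indicator-≢ : ∀ {t u} → u ≢ t → indicator t u ≡ 0ℚ
indicator-≢ {t} {u} u≢t with u ≟W t
... | yes u≡t = ⊥-elim (u≢t u≡t)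
... | no _ = refl

coeff-as-pairing : ∀ p t → coeff p t ≡ pairing (indicator t) p
coeff-as-pairing [] t = refl
coeff-as-pairing ((c , v) ∷ p) t with v ≟W t
... | yes _ = cong₂ _+_ (sym (ℚP.*-identityʳ c)) (coeff-as-pairing p t)
... | no _ = trans (coeff-as-pairing p t) (sym (trans (cong (_+ _) (ℚP.*-zeroʳ c)) (ℚP.+-identityˡ _)))

pairing-cong : ∀ g h p → (∀ u → g u ≡ h u) → pairing g p ≡ pairing h p
pairing-cong g h [] g≗h = refl
pairing-cong g h ((c , v) ∷ p) g≗h = cong₂ _+_ (cong (c *_) (g≗h v)) (pairing-cong g h p g≗h)

pairing-++ : ∀ g p q → pairing g (p ++ q) ≡ pairing g p + pairing g q
pairing-++ g [] q = sym (ℚP.+-identityˡ _)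
pairing-++ g ((c , v) ∷ p) q = trans (cong (c * g v +_) (pairing-++ g p q)) (sym (ℚP.+-assoc (c * g v) _ _))

pairing-scale : ∀ g a p → pairing g (scale a p) ≡ a * pairing g p
pairing-scale g a [] = sym (ℚP.*-zeroʳ a)
pairing-scale g a ((c , v) ∷ p) = begin
  (a * c) * g v + pairing g (scale a p)  ≡⟨ cong₂ _+_ (ℚP.*-assoc a c (g v)) (pairing-scale g a p) ⟩
  a * (c * g v) + a * pairing g p        ≡⟨ sym (ℚP.*-distribˡ-+ a _ _) ⟩
  a * (c * g v + pairing g p)            ∎

pairing-neg : ∀ g p → pairing g (neg p) ≡ - pairing g p
pairing-neg g [] = refl
pairing-neg g ((c , v) ∷ p) = begin
  - c * g v + pairing g (neg p)  ≡⟨ cong₂ _+_ (sym (ℚP.neg-distribˡ-* c (g v))) (pairing-neg g p) ⟩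
  - (c * g v) + - pairing g p    ≡⟨ sym (ℚP.neg-distrib-+ (c * g v) _) ⟩
  - (c * g v + pairing g p)      ∎

pairing-*ˡ : ∀ k g p → pairing (λ u → k * g u) p ≡ k * pairing g p
pairing-*ˡ k g [] = sym (ℚP.*-zeroʳ k)
pairing-*ˡ k g ((c , v) ∷ p) = begin
  c * (k * g v) + pairing (λ u → k * g u) p  ≡⟨ cong₂ _+_ (solve 3 (λ c k x → c :* (k :* x) := k :* (c :* x)) refl c k (g v)) (pairing-*ˡ k g p) ⟩
  k * (c * g v) + k * pairing g p            ≡⟨ sym (ℚP.*-distribˡ-+ k _ _) ⟩
  k * (c * g v + pairing g p)                ∎

pairing-*ʳ : ∀ k g p → pairing (λ u → g u * k) p ≡ pairing g p * k
pairing-*ʳ k g p = begin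
  pairing (λ u → g u * k) p  ≡⟨ pairing-cong _ (λ u → k * g u) p (λ u → ℚP.*-comm (g u) k) ⟩
  pairing (λ u → k * g u) p  ≡⟨ pairing-*ˡ k g p ⟩
  k * pairing g p            ≡⟨ ℚP.*-comm k _ ⟩
  pairing g p * k            ∎

pairing-sub : ∀ g h p → pairing (λ u → g u + - h u) p ≡ pairing g p + - pairing h p
pairing-sub g h [] = sym (ℚP.+-inverseʳ 0ℚ)
pairing-sub g h ((c , v) ∷ p) = begin
  c * (g v + - h v) + pairing (λ u → g u + - h u) p
    ≡⟨ cong (c * (g v + - h v) +_) (pairing-sub g h p) ⟩
  c * (g v + - h v) + (pairing g p + - pairing h p)
    ≡⟨ solve 5 (λ c a b P Q → c :* (a :+ :- b) :+ (P :+ :- Q) := (c :* a :+ P) :+ :- (c :* b :+ Q))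
             refl c (g v) (h v) (pairing g p) (pairing h p) ⟩
  (c * g v + pairing g p) + - (c * h v + pairing h p) ∎

coeff-cons : ∀ c v p t → coeff ((c , v) ∷ p) t ≡ c * indicator t v + coeff p t
coeff-cons c v p t = trans (coeff-as-pairing ((c , v) ∷ p) t) (cong (c * indicator t v +_) (sym (coeff-as-pairing p t)))

via-pairing : ∀ p q s t → pairing (indicator s) p ≡ pairing (indicator t) q → coeff p s ≡ coeff q t
via-pairing p q s t e = trans (coeff-as-pairing p s) (trans e (sym (coeff-as-pairing q t)))

coeff-++ : ∀ p q t → coeff (p ++ q) t ≡ coeff p t + coeff q t
coeff-++ p q t = begin
  coeff (p ++ q) t                                    ≡⟨ coeff-as-pairing (p ++ q) t ⟩
  pairing (indicator t) (p ++ q)                      ≡⟨ pairing-++ (indicator t) p q ⟩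
  pairing (indicator t) p + pairing (indicator t) q   ≡⟨ sym (cong₂ _+_ (coeff-as-pairing p t) (coeff-as-pairing q t)) ⟩
  coeff p t + coeff q t                               ∎

coeff-scale : ∀ a p t → coeff (scale a p) t ≡ a * coeff p t
coeff-scale a p t = begin
  coeff (scale a p) t                 ≡⟨ coeff-as-pairing (scale a p) t ⟩
  pairing (indicator t) (scale a p)   ≡⟨ pairing-scale (indicator t) a p ⟩
  a * pairing (indicator t) p         ≡⟨ cong (a *_) (sym (coeff-as-pairing p t)) ⟩
  a * coeff p t                       ∎

coeff-⊖ : ∀ p q t → coeff (p ⊖ q) t ≡ coeff p t + - coeff q t
coeff-⊖ p q t = begin
  coeff (p ⊖ q) t                 ≡⟨ coeff-++ p (neg q) t ⟩
  coeff p t + coeff (neg q) t     ≡⟨ cong (coeff p t +_) (coeff-as-pairing (neg q) t) ⟩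
  coeff p t + pairing (indicator t) (neg q)
                                  ≡⟨ cong (coeff p t +_) (pairing-neg (indicator t) q) ⟩
  coeff p t + - pairing (indicator t) q
                                  ≡⟨ cong (λ z → coeff p t + - z) (sym (coeff-as-pairing q t)) ⟩
  coeff p t + - coeff q t         ∎

coeff-word : ∀ v t → coeff (word v) t ≡ indicator t v
coeff-word v t = trans (coeff-cons 1ℚ v [] t) (trans (ℚP.+-identityʳ _) (ℚP.*-identityˡ _))

coeff-word-≡ : ∀ v → coeff (word v) v ≡ 1ℚ
coeff-word-≡ v = trans (coeff-word v v) (indicator-≡ v)

coeff-word-≢ : ∀ {v t} → v ≢ t → coeff (word v) t ≡ 0ℚ
coeff-word-≢ {v} {t} v≢t = trans (coeff-word v t) (indicator-≢ v≢t)

pairing-prefix : ∀ g a p → pairing g (prefix (a ∷ []) p) ≡ pairing (λ v → g (a ∷ v)) p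
pairing-prefix g a [] = refl
pairing-prefix g a ((c , v) ∷ p) = cong (c * g (a ∷ v) +_) (pairing-prefix g a p)

indicator-∷ : ∀ a t v → indicator (a ∷ t) (a ∷ v) ≡ indicator t v
indicator-∷ a t v = by-cases (v ≟W t)
  where
  by-cases : Dec (v ≡ t) → indicator (a ∷ t) (a ∷ v) ≡ indicator t v
  by-cases (yes refl) = trans (indicator-≡ (a ∷ t)) (sym (indicator-≡ t))
  by-cases (no v≢t) = trans (indicator-≢ {a ∷ t} {a ∷ v} (λ e → v≢t (∷-injectiveʳ e))) (sym (indicator-≢ v≢t))

coeff-prefix-≡ : ∀ a p t → coeff (prefix (a ∷ []) p) (a ∷ t) ≡ coeff p t
coeff-prefix-≡ a p t = via-pairing (prefix (a ∷ []) p) p (a ∷ t) t (begin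
  pairing (indicator (a ∷ t)) (prefix (a ∷ []) p)  ≡⟨ pairing-prefix _ a p ⟩
  pairing (λ v → indicator (a ∷ t) (a ∷ v)) p       ≡⟨ pairing-cong _ (indicator t) p (indicator-∷ a t) ⟩
  pairing (indicator t) p                           ∎)

pairing-zero : ∀ g p → (∀ u → g u ≡ 0ℚ) → pairing g p ≡ 0ℚ
pairing-zero g p g≡0 = begin
  pairing g p                 ≡⟨ pairing-cong g (λ u → 0ℚ * g u) p (λ u → trans (g≡0 u) (sym (ℚP.*-zeroˡ (g u)))) ⟩
  pairing (λ u → 0ℚ * g u) p  ≡⟨ pairing-*ˡ 0ℚ g p ⟩
  0ℚ * pairing g p            ≡⟨ ℚP.*-zeroˡ (pairing g p) ⟩
  0ℚ                          ∎

coeff-prefix-≢ : ∀ {a b} p t → a ≢ b → coeff (prefix (a ∷ []) p) (b ∷ t) ≡ 0ℚ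
coeff-prefix-≢ {a} {b} p t a≢b = via-pairing (prefix (a ∷ []) p) [] (b ∷ t) (b ∷ t)
  (trans (pairing-prefix (indicator (b ∷ t)) a p)
         (pairing-zero _ p (λ v → indicator-≢ (λ e → a≢b (∷-injectiveˡ e)))))

-- Syntactic support: every term of p has coefficient 0 or a word in P.
-- It is how bounds on the words produced by a product are propagated.

Supported : (Word → Set) → Poly → Set
Supported P p = All (λ e → proj₁ e ≡ 0ℚ ⊎ P (proj₂ e)) p

supported-coeff≡0 : ∀ {P} p t → Supported P p → ¬ P t → coeff p t ≡ 0ℚ
supported-coeff≡0 [] t [] ¬Pt = refl
supported-coeff≡0 {P} ((c , v) ∷ p) t (s ∷ sp) ¬Pt = begin
  coeff ((c , v) ∷ p) t         ≡⟨ coeff-cons c v p t ⟩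
  c * indicator t v + coeff p t ≡⟨ cong₂ _+_ (term s) (supported-coeff≡0 p t sp ¬Pt) ⟩
  0ℚ + 0ℚ                       ≡⟨ ℚP.+-identityˡ 0ℚ ⟩
  0ℚ                            ∎
  where
  term : c ≡ 0ℚ ⊎ P v → c * indicator t v ≡ 0ℚ
  term (inj₁ refl) = ℚP.*-zeroˡ (indicator t v)
  term (inj₂ Pv) = trans (cong (c *_) (indicator-≢ {t} {v} λ { refl → ¬Pt Pv })) (ℚP.*-zeroʳ c)

pairing-agree : ∀ {P g h} p → Supported P p → (∀ {u} → P u → g u ≡ h u) → pairing g p ≡ pairing h p
pairing-agree [] [] g≡h = refl
pairing-agree {P} {g} {h} ((c , v) ∷ p) (s ∷ sp) g≡h = cong₂ _+_ (term s) (pairing-agree p sp g≡h)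
  where
  term : c ≡ 0ℚ ⊎ P v → c * g v ≡ c * h v
  term (inj₁ refl) = trans (ℚP.*-zeroˡ (g v)) (sym (ℚP.*-zeroˡ (h v)))
  term (inj₂ Pv) = cong (c *_) (g≡h Pv)

pairing-concentrated : ∀ {Q : Word → Set} g s p → Supported (λ u → u ≡ s ⊎ Q u) p →
  (∀ {u} → Q u → g u ≡ 0ℚ) → pairing g p ≡ coeff p s * g s
pairing-concentrated {Q} g s p sp g≡0 = begin
  pairing g p                                  ≡⟨ pairing-agree p sp agree ⟩
  pairing (λ u → indicator s u * g s) p        ≡⟨ pairing-*ʳ (g s) (indicator s) p ⟩
  pairing (indicator s) p * g s                ≡⟨ cong (_* g s) (sym (coeff-as-pairing p s)) ⟩
  coeff p s * g s                              ∎
  where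
  at-s : g s ≡ indicator s s * g s
  at-s = sym (trans (cong (_* g s) (indicator-≡ s)) (ℚP.*-identityˡ (g s)))
  agree : ∀ {u} → u ≡ s ⊎ Q u → g u ≡ indicator s u * g s
  agree (inj₁ refl) = at-s
  agree {u} (inj₂ Qu) = by-cases (u ≟W s)
    where
    by-cases : Dec (u ≡ s) → g u ≡ indicator s u * g s
    by-cases (yes refl) = at-s
    by-cases (no u≢s) = trans (g≡0 Qu) (sym (trans (cong (_* g s) (indicator-≢ u≢s)) (ℚP.*-zeroˡ (g s))))

supported-++ : ∀ {P} p q → Supported P p → Supported P q → Supported P (p ++ q)
supported-++ [] q [] sq = sq
supported-++ (e ∷ p) q (s ∷ sp) sq = s ∷ supported-++ p q sp sq

supported-mono : ∀ {P Q : Word → Set} → (∀ {v} → P v → Q v) → ∀ p → Supported P p → Supported Q p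
supported-mono f p = All.map λ { (inj₁ c≡0) → inj₁ c≡0 ; (inj₂ Pv) → inj₂ (f Pv) }

supported-scale : ∀ {P} a p → Supported P p → Supported P (scale a p)
supported-scale a [] [] = []
supported-scale a (e ∷ p) (inj₁ c≡0 ∷ sp) = inj₁ (trans (cong (a *_) c≡0) (ℚP.*-zeroʳ a)) ∷ supported-scale a p sp
supported-scale a (e ∷ p) (inj₂ Pv ∷ sp) = inj₂ Pv ∷ supported-scale a p sp

supported-scale-0 : ∀ {P a} p → a ≡ 0ℚ → Supported P (scale a p)
supported-scale-0 [] a≡0 = []
supported-scale-0 ((c , v) ∷ p) refl = inj₁ (ℚP.*-zeroˡ c) ∷ supported-scale-0 p refl

supported-neg : ∀ {P} p → Supported P p → Supported P (neg p)
supported-neg [] [] = []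
supported-neg (e ∷ p) (inj₁ c≡0 ∷ sp) = inj₁ (cong -_ c≡0) ∷ supported-neg p sp
supported-neg (e ∷ p) (inj₂ Pv ∷ sp) = inj₂ Pv ∷ supported-neg p sp

supported-prefix : ∀ {P : Word → Set} a p → Supported (λ v → P (a ∷ v)) p → Supported P (prefix (a ∷ []) p)
supported-prefix a [] [] = []
supported-prefix a (e ∷ p) (s ∷ sp) = s ∷ supported-prefix a p sp

supported-word : ∀ {P : Word → Set} v → P v → Supported P (word v)
supported-word v Pv = inj₂ Pv ∷ []

-- Semantic support.  Pairings only depend on the coefficient function of
-- a polynomial (a list may repeat a word); this needs an induction that
-- removes all terms carrying a given word.

remove : Word → Poly → Poly
remove s [] = []
remove s ((c , v) ∷ p) with v ≟W s
... | yes _ = remove s p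
... | no _ = (c , v) ∷ remove s p

remove-length : ∀ s p → length (remove s p) N.≤ length p
remove-length s [] = z≤n
remove-length s ((c , v) ∷ p) with v ≟W s
... | yes _ = ℕP.m≤n⇒m≤1+n (remove-length s p)
... | no _ = s≤s (remove-length s p)

remove-shrinks : ∀ c s p → length (remove s ((c , s) ∷ p)) N.≤ length p
remove-shrinks c s p with s ≟W s
... | yes _ = remove-length s p
... | no s≢s = ⊥-elim (s≢s refl)

pairing-remove : ∀ g s p → pairing g p ≡ coeff p s * g s + pairing g (remove s p)
pairing-remove g s [] = sym (trans (cong (_+ 0ℚ) (ℚP.*-zeroˡ (g s))) (ℚP.+-identityˡ 0ℚ))
pairing-remove g s ((c , v) ∷ p) with v ≟W s
... | yes refl rewrite pairing-remove g s p =
  solve 4 (λ c k x r → c :* x :+ (k :* x :+ r) := (c :+ k) :* x :+ r) refl c (coeff p s) (g s) (pairing g (remove s p))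
... | no _ rewrite pairing-remove g s p =
  solve 5 (λ c k x r z → c :* z :+ (k :* x :+ r) := k :* x :+ (c :* z :+ r)) refl c (coeff p s) (g s) (pairing g (remove s p)) (g v)

coeff-remove-≢ : ∀ s p t → t ≢ s → coeff (remove s p) t ≡ coeff p t
coeff-remove-≢ s [] t t≢s = refl
coeff-remove-≢ s ((c , v) ∷ p) t t≢s with v ≟W s
... | yes refl = begin
  coeff (remove s p) t            ≡⟨ coeff-remove-≢ s p t t≢s ⟩
  coeff p t                       ≡⟨ sym (ℚP.+-identityˡ _) ⟩
  0ℚ + coeff p t                  ≡⟨ cong (_+ coeff p t) (sym (trans (cong (c *_) (indicator-≢ (λ e → t≢s (sym e)))) (ℚP.*-zeroʳ c))) ⟩
  c * indicator t s + coeff p t   ≡⟨ sym (coeff-cons c s p t) ⟩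
  coeff ((c , s) ∷ p) t           ∎
... | no _ = begin
  coeff ((c , v) ∷ remove s p) t          ≡⟨ coeff-cons c v (remove s p) t ⟩
  c * indicator t v + coeff (remove s p) t ≡⟨ cong (c * indicator t v +_) (coeff-remove-≢ s p t t≢s) ⟩
  c * indicator t v + coeff p t           ≡⟨ sym (coeff-cons c v p t) ⟩
  coeff ((c , v) ∷ p) t                   ∎

coeff-remove-≡ : ∀ s p → coeff (remove s p) s ≡ 0ℚ
coeff-remove-≡ s [] = refl
coeff-remove-≡ s ((c , v) ∷ p) with v ≟W s
... | yes _ = coeff-remove-≡ s p
... | no v≢s = begin
  coeff ((c , v) ∷ remove s p) s             ≡⟨ coeff-cons c v (remove s p) s ⟩
  c * indicator s v + coeff (remove s p) s   ≡⟨ cong₂ _+_ (trans (cong (c *_) (indicator-≢ v≢s)) (ℚP.*-zeroʳ c)) (coeff-remove-≡ s p) ⟩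
  0ℚ + 0ℚ                                    ≡⟨ ℚP.+-identityˡ 0ℚ ⟩
  0ℚ                                         ∎

isolate-word : ∀ p s .{{_ : NonZero (coeff p s)}} →
  word s ≈ scale (1/ coeff p s) (p ⊕ scale (- 1ℚ) (remove s p))
isolate-word p s t = sym (begin
  coeff (scale f⁻¹ (p ⊕ scale (- 1ℚ) r)) t      ≡⟨ coeff-scale f⁻¹ (p ⊕ scale (- 1ℚ) r) t ⟩
  f⁻¹ * coeff (p ⊕ scale (- 1ℚ) r) t            ≡⟨ cong (f⁻¹ *_) (trans (coeff-++ p (scale (- 1ℚ) r) t) (cong (coeff p t +_) (coeff-scale (- 1ℚ) r t))) ⟩
  f⁻¹ * (coeff p t + - 1ℚ * coeff r t)          ≡⟨ by-cases (s ≟W t) ⟩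
  coeff (word s) t                              ∎)
  where
  r : Poly
  r = remove s p
  f⁻¹ : ℚ
  f⁻¹ = 1/ coeff p s
  by-cases : Dec (s ≡ t) → f⁻¹ * (coeff p t + - 1ℚ * coeff r t) ≡ coeff (word s) t
  by-cases (yes refl) = begin
    f⁻¹ * (coeff p s + - 1ℚ * coeff r s)    ≡⟨ cong (λ z → f⁻¹ * (coeff p s + - 1ℚ * z)) (coeff-remove-≡ s p) ⟩
    f⁻¹ * (coeff p s + - 1ℚ * 0ℚ)           ≡⟨ cong (f⁻¹ *_) (solve 1 (λ a → a :+ :- con 1ℚ :* con 0ℚ := a) refl (coeff p s)) ⟩
    f⁻¹ * coeff p s                         ≡⟨ ℚP.*-inverseˡ (coeff p s) ⟩
    1ℚ                                      ≡⟨ sym (coeff-word-≡ s) ⟩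
    coeff (word s) s                        ∎
  by-cases (no s≢t) = begin
    f⁻¹ * (coeff p t + - 1ℚ * coeff r t)    ≡⟨ cong (λ z → f⁻¹ * (coeff p t + - 1ℚ * z)) (coeff-remove-≢ s p t (λ e → s≢t (sym e))) ⟩
    f⁻¹ * (coeff p t + - 1ℚ * coeff p t)    ≡⟨ cong (f⁻¹ *_) (solve 1 (λ a → a :+ :- con 1ℚ :* a := con 0ℚ) refl (coeff p t)) ⟩
    f⁻¹ * 0ℚ                                ≡⟨ ℚP.*-zeroʳ f⁻¹ ⟩
    0ℚ                                      ≡⟨ sym (coeff-word-≢ s≢t) ⟩
    coeff (word s) t                        ∎

supported-remove : ∀ {Q : Word → Set} s p → Supported (λ v → v ≡ s ⊎ Q v) p → Supported Q (remove s p)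
supported-remove s [] [] = []
supported-remove s ((c , v) ∷ p) (sv ∷ sp) with v ≟W s
... | yes _ = supported-remove s p sp
supported-remove s ((c , v) ∷ p) (inj₁ c≡0 ∷ sp) | no _ = inj₁ c≡0 ∷ supported-remove s p sp
supported-remove s ((c , v) ∷ p) (inj₂ (inj₁ v≡s) ∷ sp) | no v≢s = ⊥-elim (v≢s v≡s)
supported-remove s ((c , v) ∷ p) (inj₂ (inj₂ Qv) ∷ sp) | no _ = inj₂ Qv ∷ supported-remove s p sp

pairing-vanishes : ∀ g p → (∀ t → coeff p t ≡ 0ℚ ⊎ g t ≡ 0ℚ) → pairing g p ≡ 0ℚ
pairing-vanishes g p = go (length p) p ℕP.≤-refl
  where
  go : ∀ n p → length p N.≤ n → (∀ t → coeff p t ≡ 0ℚ ⊎ g t ≡ 0ℚ) → pairing g p ≡ 0ℚ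
  go n [] _ _ = refl
  go (suc n) p@((c , s) ∷ q) (s≤s len) vanish = begin
    pairing g p                                       ≡⟨ pairing-remove g s p ⟩
    coeff p s * g s + pairing g (remove s p)          ≡⟨ cong₂ _+_ (at-s (vanish s)) (go n (remove s p) len′ vanish′) ⟩
    0ℚ + 0ℚ                                           ≡⟨ ℚP.+-identityˡ 0ℚ ⟩
    0ℚ                                                ∎
    where
    len′ : length (remove s p) N.≤ n
    len′ = ℕP.≤-trans (remove-shrinks c s q) len
    at-s : coeff p s ≡ 0ℚ ⊎ g s ≡ 0ℚ → coeff p s * g s ≡ 0ℚ
    at-s (inj₁ e) = trans (cong (_* g s) e) (ℚP.*-zeroˡ (g s))
    at-s (inj₂ e) = trans (cong (coeff p s *_) e) (ℚP.*-zeroʳ (coeff p s))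
    vanish′ : ∀ t → coeff (remove s p) t ≡ 0ℚ ⊎ g t ≡ 0ℚ
    vanish′ t with t ≟W s
    ... | yes refl = inj₁ (coeff-remove-≡ s p)
    ... | no t≢s with vanish t
    ...   | inj₁ e = inj₁ (trans (coeff-remove-≢ s p t t≢s) e)
    ...   | inj₂ e = inj₂ e

pairing-determined : ∀ g h p → (∀ t → coeff p t ≡ 0ℚ ⊎ g t ≡ h t) → pairing g p ≡ pairing h p
pairing-determined g h p agree = difference-zero _ _ (begin
  pairing g p + - pairing h p         ≡⟨ sym (pairing-sub g h p) ⟩
  pairing (λ u → g u + - h u) p       ≡⟨ pairing-vanishes _ p vanish ⟩
  0ℚ                                  ∎)
  where
  vanish : ∀ t → coeff p t ≡ 0ℚ ⊎ g t + - h t ≡ 0ℚ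
  vanish t with agree t
  ... | inj₁ e = inj₁ e
  ... | inj₂ e = inj₂ (trans (cong (_+ - h t) e) (ℚP.+-inverseʳ (h t)))

data EndsInY : Word → Set where
  just-y : EndsInY (y ∷ [])
  extend : ∀ a {w} → EndsInY w → EndsInY (a ∷ w)

data H0 : Word → Set where
  h0-empty : H0 []
  h0-x : ∀ {w} → EndsInY w → H0 (x ∷ w)

data Height : ℕ → Word → Set where
  height0 : ∀ {w} → H0 w → Height 0 w
  heightS : ∀ {j w} → Height j w → Height (suc j) (y ∷ w)

Height≤ : ℕ → Word → Set
Height≤ k v = Σ ℕ λ j → j N.≤ k × Height j v

Height< : ℕ → Word → Set
Height< k v = Σ ℕ λ j → j N.< k × Height j v

Y^ : ℕ → Word
Y^ j = replicate j y

height-unique : ∀ {j k v} → Height j v → Height k v → j ≡ k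
height-unique (height0 _) (height0 _) = refl
height-unique (height0 ()) (heightS _)
height-unique (heightS _) (height0 ())
height-unique (heightS a) (heightS b) = cong suc (height-unique a b)

height-Y^ : ∀ j {h} → H0 h → Height j (Y^ j ++ h)
height-Y^ zero hh = height0 hh
height-Y^ (suc j) hh = heightS (height-Y^ j hh)

height-Y^-only : ∀ j → Height j (Y^ j)
height-Y^-only j = subst (Height j) (++-identityʳ (Y^ j)) (height-Y^ j h0-empty)

height-split : ∀ {k v} → Height k v → Σ Word λ u → H0 u × v ≡ Y^ k ++ u
height-split (height0 h) = _ , h , refl
height-split (heightS hv) with height-split hv
... | u , hu , refl = u , hu , refl

height-≢ : ∀ {j k v w} → Height j v → Height k w → k N.< j → w ≢ v
height-≢ hv hw k<j refl = ℕP.<-irrefl (height-unique hw hv) k<j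

height-endsInY : ∀ {j w} → Height j w → EndsInY (y ∷ w)
height-endsInY (height0 h0-empty) = just-y
height-endsInY (height0 (h0-x e)) = extend y (extend x e)
height-endsInY (heightS h) = extend y (height-endsInY h)

endsInY-snoc : ∀ u → EndsInY (u ++ y ∷ [])
endsInY-snoc [] = just-y
endsInY-snoc (a ∷ u) = extend a (endsInY-snoc u)

endsInY-Y^ : ∀ j → EndsInY (y ∷ Y^ j)
endsInY-Y^ j = height-endsInY (height-Y^-only j)

δ-endsInY : ∀ {w} → EndsInY w → δ w ≡ 0ℚ
δ-endsInY just-y = refl
δ-endsInY (extend a e) = refl

endsInY→snoc : ∀ {w} → EndsInY w → Σ Word λ u → w ≡ u ++ y ∷ []
endsInY→snoc just-y = [] , refl
endsInY→snoc (extend a e) with endsInY→snoc e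
... | u , refl = a ∷ u , refl

H0→IsH0Word : ∀ {w} → H0 w → IsH0Word w
H0→IsH0Word h0-empty = empty
H0→IsH0Word (h0-x e) with endsInY→snoc e
... | u , refl = xy u

IsH0Word→H0 : ∀ {w} → IsH0Word w → H0 w
IsH0Word→H0 empty = h0-empty
IsH0Word→H0 (xy u) = h0-x (endsInY-snoc u)

endsInY? : ∀ w → Dec (EndsInY w)
endsInY? [] = no λ ()
endsInY? (x ∷ []) = no λ { (extend _ ()) }
endsInY? (y ∷ []) = yes just-y
endsInY? (a ∷ b ∷ w) with endsInY? (b ∷ w)
... | yes e = yes (extend a e)
... | no ¬e = no λ { (extend _ e) → ¬e e }

h0? : ∀ w → Dec (H0 w)
h0? [] = yes h0-empty
h0? (y ∷ w) = no λ ()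
h0? (x ∷ w) with endsInY? w
... | yes e = yes (h0-x e)
... | no ¬e = no λ { (h0-x e) → ¬e e }

InH0-coeff≡0 : ∀ p u → InH0 p → ¬ H0 u → coeff p u ≡ 0ℚ
InH0-coeff≡0 p u hp ¬hu with coeff p u ℚP.≟ 0ℚ
... | yes e = e
... | no ne = ⊥-elim (¬hu (IsH0Word→H0 (hp u ne)))

height≤-y : ∀ {k v} → Height≤ k v → Height≤ (suc k) (y ∷ v)
height≤-y (j , j≤k , h) = suc j , s≤s j≤k , heightS h

height<-y : ∀ {k v} → Height< k v → Height< (suc k) (y ∷ v)
height<-y (j , j<k , h) = suc j , s≤s j<k , heightS h

height≤-h0 : ∀ {k v} → H0 v → Height≤ k v
height≤-h0 h = 0 , z≤n , height0 h

height<-h0 : ∀ {k v} → H0 v → Height< (suc k) v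
height<-h0 h = 0 , s≤s z≤n , height0 h

pairing-agree-InH0 : ∀ g h p → InH0 p → (∀ {u} → H0 u → g u ≡ h u) → pairing g p ≡ pairing h p
pairing-agree-InH0 g h p hp agree = pairing-determined g h p by-cases
  where
  by-cases : ∀ t → coeff p t ≡ 0ℚ ⊎ g t ≡ h t
  by-cases t with h0? t
  ... | yes ht = inj₂ (agree ht)
  ... | no ¬ht = inj₁ (InH0-coeff≡0 p t hp ¬ht)

pairing-word : ∀ g u → pairing g (word u) ≡ g u
pairing-word g u = trans (ℚP.+-identityʳ _) (ℚP.*-identityˡ (g u))

record Triangular (ch : Choice) : Set where
  field
    times-y : ∀ {j a} → Height j a →
      Supported (λ v → v ≡ y ∷ a ⊎ Height≤ j v) (wordProd ch a (y ∷ [])) ×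
      coeff (wordProd ch a (y ∷ [])) (y ∷ a) ≡ natℚ (suc j)
    h0-times-Y^ : ∀ j {h} → H0 h →
      Supported (λ v → v ≡ Y^ j ++ h ⊎ Height< j v) (wordProd ch h (Y^ j)) ×
      coeff (wordProd ch h (Y^ j)) (Y^ j ++ h) ≡ 1ℚ
    h0-times-height : ∀ {j h b} → H0 h → Height j b → Supported (Height≤ j) (wordProd ch h b)

AllV : (Poly → Set) → ∀ {n} → Vec Poly n → Set
AllV P ps = ∀ i → P (lookup ps i)

module Expansion (ch : Choice) (tri : Triangular ch) where
  open Triangular tri

  prod : Word → Word → Poly
  prod = wordProd ch

  mul-cons : ∀ e p q → mul ch (e ∷ p) q ≡ mul ch (e ∷ []) q ++ mul ch p q
  mul-cons (c , u) p q = cong (_++ mul ch p q) (sym (++-identityʳ _))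

  mul-single-cons : ∀ c u d v q →
    mul ch ((c , u) ∷ []) ((d , v) ∷ q) ≡ scale (c * d) (prod u v) ++ mul ch ((c , u) ∷ []) q
  mul-single-cons c u d v q = ++-assoc (scale (c * d) (prod u v)) _ []

  coeff-mul-single : ∀ c u q t → coeff (mul ch ((c , u) ∷ []) q) t ≡ c * pairing (λ v → coeff (prod u v) t) q
  coeff-mul-single c u [] t = sym (ℚP.*-zeroʳ c)
  coeff-mul-single c u ((d , v) ∷ q) t = begin
    coeff (mul ch ((c , u) ∷ []) ((d , v) ∷ q)) t
      ≡⟨ cong (λ r → coeff r t) (mul-single-cons c u d v q) ⟩
    coeff (scale (c * d) (prod u v) ++ mul ch ((c , u) ∷ []) q) t
      ≡⟨ coeff-++ (scale (c * d) (prod u v)) _ t ⟩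
    coeff (scale (c * d) (prod u v)) t + coeff (mul ch ((c , u) ∷ []) q) t
      ≡⟨ cong₂ _+_ (coeff-scale (c * d) (prod u v) t) (coeff-mul-single c u q t) ⟩
    (c * d) * X + c * P
      ≡⟨ solve 4 (λ c d X P → (c :* d) :* X :+ c :* P := c :* (d :* X :+ P)) refl c d X P ⟩
    c * (d * X + P) ∎
    where
    X P : ℚ
    X = coeff (prod u v) t
    P = pairing (λ v → coeff (prod u v) t) q

  coeff-mul : ∀ p q t → coeff (mul ch p q) t ≡ pairing (λ u → pairing (λ v → coeff (prod u v) t) q) p
  coeff-mul [] q t = refl
  coeff-mul ((c , u) ∷ p) q t = begin
    coeff (mul ch ((c , u) ∷ p) q) t
      ≡⟨ cong (λ r → coeff r t) (mul-cons (c , u) p q) ⟩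
    coeff (mul ch ((c , u) ∷ []) q ++ mul ch p q) t
      ≡⟨ coeff-++ (mul ch ((c , u) ∷ []) q) (mul ch p q) t ⟩
    coeff (mul ch ((c , u) ∷ []) q) t + coeff (mul ch p q) t
      ≡⟨ cong₂ _+_ (coeff-mul-single c u q t) (coeff-mul p q t) ⟩
    c * pairing (λ v → coeff (prod u v) t) q + pairing (λ u → pairing (λ v → coeff (prod u v) t) q) p ∎

  coeff-mul-left : ∀ p q t → coeff (mul ch p q) t ≡ pairing (λ u → coeff (mul ch (word u) q) t) p
  coeff-mul-left p q t = begin
    coeff (mul ch p q) t
      ≡⟨ coeff-mul p q t ⟩
    pairing (λ u → pairing (λ v → coeff (prod u v) t) q) p
      ≡⟨ pairing-cong _ _ p (λ u → sym (trans (coeff-mul (word u) q t) (pairing-word (λ u′ → pairing (λ v → coeff (prod u′ v) t) q) u))) ⟩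
    pairing (λ u → coeff (mul ch (word u) q) t) p ∎

  coeff-mul-⊕ : ∀ p q r t → coeff (mul ch (p ⊕ q) r) t ≡ coeff (mul ch p r) t + coeff (mul ch q r) t
  coeff-mul-⊕ p q r t = begin
    coeff (mul ch (p ⊕ q) r) t                       ≡⟨ coeff-mul-left (p ⊕ q) r t ⟩
    pairing g (p ++ q)                               ≡⟨ pairing-++ g p q ⟩
    pairing g p + pairing g q                        ≡⟨ sym (cong₂ _+_ (coeff-mul-left p r t) (coeff-mul-left q r t)) ⟩
    coeff (mul ch p r) t + coeff (mul ch q r) t      ∎
    where
    g : Word → ℚ
    g u = coeff (mul ch (word u) r) t

  coeff-mul-scale : ∀ c p r t → coeff (mul ch (scale c p) r) t ≡ c * coeff (mul ch p r) t
  coeff-mul-scale c p r t = begin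
    coeff (mul ch (scale c p) r) t    ≡⟨ coeff-mul-left (scale c p) r t ⟩
    pairing g (scale c p)             ≡⟨ pairing-scale g c p ⟩
    c * pairing g p                   ≡⟨ cong (c *_) (sym (coeff-mul-left p r t)) ⟩
    c * coeff (mul ch p r) t          ∎
    where
    g : Word → ℚ
    g u = coeff (mul ch (word u) r) t

  supported-mul : ∀ {Q R P : Word → Set} p q → Supported Q p → Supported R q →
    (∀ {u v} → Q u → R v → Supported P (prod u v)) → Supported P (mul ch p q)
  supported-mul [] q [] sq prodP = []
  supported-mul {Q} {R} {P} ((c , u) ∷ p) q (su ∷ sp) sq prodP =
    subst (Supported P) (sym (mul-cons (c , u) p q))
      (supported-++ (mul ch ((c , u) ∷ []) q) (mul ch p q) (single q sq) (supported-mul p q sp sq prodP))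
    where
    single : ∀ q → Supported R q → Supported P (mul ch ((c , u) ∷ []) q)
    single [] [] = []
    single ((d , v) ∷ q) (sv ∷ sq) =
      subst (Supported P) (sym (mul-single-cons c u d v q))
        (supported-++ (scale (c * d) (prod u v)) _ (head su sv) (single q sq))
      where
      head : c ≡ 0ℚ ⊎ Q u → d ≡ 0ℚ ⊎ R v → Supported P (scale (c * d) (prod u v))
      head (inj₁ refl) _ = supported-scale-0 (prod u v) (ℚP.*-zeroˡ d)
      head (inj₂ _) (inj₁ refl) = supported-scale-0 (prod u v) (ℚP.*-zeroʳ c)
      head (inj₂ Qu) (inj₂ Rv) = supported-scale (c * d) (prod u v) (prodP Qu Rv)

  ypow-leading : ∀ i → Supported (λ v → v ≡ Y^ i ⊎ Height< i v) (ypow ch i) × coeff (ypow ch i) (Y^ i) ≡ factℚ i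
  ypow-leading zero = supported-word [] (inj₁ refl) , coeff-word-≡ []
  ypow-leading (suc i) =
    supported-mul (ypow ch i) (word (y ∷ [])) (proj₁ IH) (supported-word (y ∷ []) refl) step , leading
    where
    IH : Supported (λ v → v ≡ Y^ i ⊎ Height< i v) (ypow ch i) × coeff (ypow ch i) (Y^ i) ≡ factℚ i
    IH = ypow-leading i
    t : Word
    t = Y^ (suc i)
    step : ∀ {u v} → u ≡ Y^ i ⊎ Height< i u → v ≡ y ∷ [] → Supported (λ w → w ≡ t ⊎ Height< (suc i) w) (prod u v)
    step (inj₁ refl) refl = supported-mono lift _ (proj₁ (times-y (height-Y^-only i)))
      where
      lift : ∀ {w} → w ≡ t ⊎ Height≤ i w → w ≡ t ⊎ Height< (suc i) w
      lift (inj₁ e) = inj₁ e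
      lift (inj₂ (j , j≤i , h)) = inj₂ (j , s≤s j≤i , h)
    step {u} (inj₂ (k , k<i , hk)) refl = supported-mono lift _ (proj₁ (times-y hk))
      where
      lift : ∀ {w} → w ≡ y ∷ u ⊎ Height≤ k w → w ≡ t ⊎ Height< (suc i) w
      lift (inj₁ refl) = inj₂ (suc k , s≤s k<i , heightS hk)
      lift (inj₂ (j , j≤k , h)) = inj₂ (j , s≤s (ℕP.≤-trans j≤k (ℕP.<⇒≤ k<i)) , h)
    lower : ∀ {u} → Height< i u → coeff (prod u (y ∷ [])) t ≡ 0ℚ
    lower {u} (k , k<i , hk) = supported-coeff≡0 _ t (proj₁ (times-y hk)) not-there
      where
      not-there : ¬ (t ≡ y ∷ u ⊎ Height≤ k t)
      not-there (inj₁ e) = height-≢ (heightS (height-Y^-only i)) (heightS hk) (s≤s k<i) (sym e)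
      not-there (inj₂ (j , j≤k , hj)) = height-≢ (height-Y^-only (suc i)) hj (s≤s (ℕP.≤-trans j≤k (ℕP.<⇒≤ k<i))) refl
    leading : coeff (mul ch (ypow ch i) (word (y ∷ []))) t ≡ factℚ (suc i)
    leading = begin
      coeff (mul ch (ypow ch i) (word (y ∷ []))) t
        ≡⟨ coeff-mul (ypow ch i) (word (y ∷ [])) t ⟩
      pairing (λ u → pairing (λ v → coeff (prod u v) t) (word (y ∷ []))) (ypow ch i)
        ≡⟨ pairing-cong _ _ (ypow ch i) (λ u → pairing-word (λ v → coeff (prod u v) t) (y ∷ [])) ⟩
      pairing (λ u → coeff (prod u (y ∷ [])) t) (ypow ch i)
        ≡⟨ pairing-concentrated _ (Y^ i) (ypow ch i) (proj₁ IH) lower ⟩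
      coeff (ypow ch i) (Y^ i) * coeff (prod (Y^ i) (y ∷ [])) t
        ≡⟨ cong₂ _*_ (proj₂ IH) (proj₂ (times-y (height-Y^-only i))) ⟩
      factℚ i * natℚ (suc i)
        ≡⟨ ℚP.*-comm (factℚ i) _ ⟩
      factℚ (suc i) ∎

  h0-times-ypow : ∀ i {h} → H0 h →
    Supported (λ v → v ≡ Y^ i ++ h ⊎ Height< i v) (mul ch (word h) (ypow ch i)) ×
    coeff (mul ch (word h) (ypow ch i)) (Y^ i ++ h) ≡ factℚ i
  h0-times-ypow i {h} hh =
    supported-mul (word h) (ypow ch i) (supported-word h refl) (proj₁ (ypow-leading i)) step , leading
    where
    t : Word
    t = Y^ i ++ h
    step : ∀ {u v} → u ≡ h → v ≡ Y^ i ⊎ Height< i v → Supported (λ w → w ≡ t ⊎ Height< i w) (prod u v)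
    step refl (inj₁ refl) = proj₁ (h0-times-Y^ i hh)
    step refl (inj₂ (k , k<i , hk)) =
      supported-mono (λ { (j , j≤k , hj) → inj₂ (j , ℕP.≤-<-trans j≤k k<i , hj) }) _ (h0-times-height hh hk)
    lower : ∀ {v} → Height< i v → coeff (prod h v) t ≡ 0ℚ
    lower (k , k<i , hk) = supported-coeff≡0 _ t (h0-times-height hh hk)
      λ { (j , j≤k , hj) → height-≢ (height-Y^ i hh) hj (ℕP.≤-<-trans j≤k k<i) refl }
    leading : coeff (mul ch (word h) (ypow ch i)) t ≡ factℚ i
    leading = begin
      coeff (mul ch (word h) (ypow ch i)) t
        ≡⟨ coeff-mul (word h) (ypow ch i) t ⟩
      pairing (λ u → pairing (λ v → coeff (prod u v) t) (ypow ch i)) (word h)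
        ≡⟨ pairing-word (λ u → pairing (λ v → coeff (prod u v) t) (ypow ch i)) h ⟩
      pairing (λ v → coeff (prod h v) t) (ypow ch i)
        ≡⟨ pairing-concentrated _ (Y^ i) (ypow ch i) (proj₁ (ypow-leading i)) lower ⟩
      coeff (ypow ch i) (Y^ i) * coeff (prod h (Y^ i)) t
        ≡⟨ cong₂ _*_ (proj₂ (ypow-leading i)) (proj₂ (h0-times-Y^ i hh)) ⟩
      factℚ i * 1ℚ
        ≡⟨ ℚP.*-identityʳ (factℚ i) ⟩
      factℚ i ∎

  basisCoeff : ℕ → Word → Word → ℚ
  basisCoeff i t u = coeff (mul ch (word u) (ypow ch i)) t

  basisCoeff-above : ∀ i {k t u} → H0 u → Height k t → i N.< k → basisCoeff i t u ≡ 0ℚ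
  basisCoeff-above i {k} {t} {u} hu ht i<k = supported-coeff≡0 _ t (proj₁ (h0-times-ypow i hu)) not-there
    where
    not-there : ¬ (t ≡ Y^ i ++ u ⊎ Height< i t)
    not-there (inj₁ e) = height-≢ ht (height-Y^ i hu) i<k (sym e)
    not-there (inj₂ (j , j<i , hj)) = height-≢ ht hj (ℕP.<-trans j<i i<k) refl

  basisCoeff-diagonal : ∀ i {u w} → H0 u → H0 w → basisCoeff i (Y^ i ++ w) u ≡ factℚ i * indicator w u
  basisCoeff-diagonal i {u} {w} hu hw = by-cases (u ≟W w)
    where
    by-cases : Dec (u ≡ w) → basisCoeff i (Y^ i ++ w) u ≡ factℚ i * indicator w u
    by-cases (yes refl) = trans (proj₂ (h0-times-ypow i hu)) (sym (trans (cong (factℚ i *_) (indicator-≡ u)) (ℚP.*-identityʳ _)))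
    by-cases (no u≢w) = trans (supported-coeff≡0 _ _ (proj₁ (h0-times-ypow i hu)) not-there)
                              (sym (trans (cong (factℚ i *_) (indicator-≢ u≢w)) (ℚP.*-zeroʳ (factℚ i))))
      where
      not-there : ¬ (Y^ i ++ w ≡ Y^ i ++ u ⊎ Height< i (Y^ i ++ w))
      not-there (inj₁ e) = u≢w (sym (++-cancelˡ (Y^ i) w u e))
      not-there (inj₂ (j , j<i , hj)) = height-≢ (height-Y^ i hw) hj j<i refl

  coeff-linComb-cons : ∀ {n} p (ps : Vec Poly n) s t →
    coeff (linComb ch (p ∷ ps) s) t ≡ coeff (mul ch p (ypow ch s)) t + coeff (linComb ch ps (suc s)) t
  coeff-linComb-cons p ps s t = coeff-++ (mul ch p (ypow ch s)) (linComb ch ps (suc s)) t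

  coeff-linComb-snoc : ∀ {n} (ps : Vec Poly n) p s t →
    coeff (linComb ch (ps ∷ʳ p) s) t ≡ coeff (linComb ch ps s) t + coeff (mul ch p (ypow ch (s N.+ n))) t
  coeff-linComb-snoc [] p s t rewrite ℕP.+-identityʳ s = begin
    coeff (mul ch p (ypow ch s) ++ []) t   ≡⟨ cong (λ r → coeff r t) (++-identityʳ (mul ch p (ypow ch s))) ⟩
    coeff (mul ch p (ypow ch s)) t         ≡⟨ sym (ℚP.+-identityˡ _) ⟩
    0ℚ + coeff (mul ch p (ypow ch s)) t    ∎
  coeff-linComb-snoc {suc n} (q ∷ ps) p s t rewrite ℕP.+-suc s n = begin
    coeff (linComb ch (q ∷ (ps ∷ʳ p)) s) t             ≡⟨ coeff-linComb-cons q (ps ∷ʳ p) s t ⟩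
    A + coeff (linComb ch (ps ∷ʳ p) (suc s)) t         ≡⟨ cong (A +_) (coeff-linComb-snoc ps p (suc s) t) ⟩
    A + (coeff (linComb ch ps (suc s)) t + B)          ≡⟨ sym (ℚP.+-assoc A _ B) ⟩
    (A + coeff (linComb ch ps (suc s)) t) + B          ≡⟨ cong (_+ B) (sym (coeff-linComb-cons q ps s t)) ⟩
    coeff (linComb ch (q ∷ ps) s) t + B                ∎
    where
    A B : ℚ
    A = coeff (mul ch q (ypow ch s)) t
    B = coeff (mul ch p (ypow ch (suc s N.+ n))) t

  coeff-mul-ypow-above : ∀ s {k t} p → InH0 p → Height k t → s N.< k → coeff (mul ch p (ypow ch s)) t ≡ 0ℚ
  coeff-mul-ypow-above s {k} {t} p hp ht s<k = begin
    coeff (mul ch p (ypow ch s)) t        ≡⟨ coeff-mul-left p (ypow ch s) t ⟩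
    pairing (basisCoeff s t) p            ≡⟨ pairing-agree-InH0 _ (λ _ → 0ℚ) p hp (λ hu → basisCoeff-above s hu ht s<k) ⟩
    pairing (λ _ → 0ℚ) p                  ≡⟨ pairing-zero _ p (λ _ → refl) ⟩
    0ℚ                                    ∎

  coeff-linComb-below : ∀ {n} (ps : Vec Poly n) s {k t} → Height k t → s N.+ n N.≤ k →
    AllV InH0 ps → coeff (linComb ch ps s) t ≡ 0ℚ
  coeff-linComb-below [] s ht le hps = refl
  coeff-linComb-below {suc n} (p ∷ ps) s {k} {t} ht le hps = begin
    coeff (linComb ch (p ∷ ps) s) t
      ≡⟨ coeff-linComb-cons p ps s t ⟩
    coeff (mul ch p (ypow ch s)) t + coeff (linComb ch ps (suc s)) t
      ≡⟨ cong₂ _+_ (coeff-mul-ypow-above s p (hps zero) ht s<k)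
                   (coeff-linComb-below ps (suc s) ht le′ (λ i → hps (suc i))) ⟩
    0ℚ + 0ℚ
      ≡⟨ ℚP.+-identityˡ 0ℚ ⟩
    0ℚ ∎
    where
    le′ : suc s N.+ n N.≤ k
    le′ = subst (N._≤ k) (ℕP.+-suc s n) le
    s<k : s N.< k
    s<k = ℕP.<-≤-trans (s≤s (ℕP.m≤m+n s n)) le′

  -- the vector view from the right, for induction on the last entry
  data SnocView : ∀ {n} → Vec Poly n → Set where
    nil : SnocView []
    snoc : ∀ {n} (xs : Vec Poly n) z → SnocView (xs ∷ʳ z)

  snocView : ∀ {n} (v : Vec Poly n) → SnocView v
  snocView [] = nil
  snocView (a ∷ v) with snocView v
  ... | nil = snoc [] a
  ... | snoc xs z = snoc (a ∷ xs) z

  allV-snoc : ∀ {P : Poly → Set} {n} (xs : Vec Poly n) z → AllV P xs → P z → AllV P (xs ∷ʳ z)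
  allV-snoc [] z hxs hz zero = hz
  allV-snoc (a ∷ xs) z hxs hz zero = hxs zero
  allV-snoc {P} (a ∷ xs) z hxs hz (suc i) = allV-snoc {P} xs z (λ j → hxs (suc j)) hz i

  allV-init : ∀ {P : Poly → Set} {n} (xs : Vec Poly n) z → AllV P (xs ∷ʳ z) → AllV P xs
  allV-init (a ∷ xs) z h zero = h zero
  allV-init {P} (a ∷ xs) z h (suc i) = allV-init {P} xs z (λ j → h (suc j)) i

  allV-last : ∀ {P : Poly → Set} {n} (xs : Vec Poly n) z → AllV P (xs ∷ʳ z) → P z
  allV-last [] z h = h zero
  allV-last {P} (a ∷ xs) z h = allV-last {P} xs z (λ j → h (suc j))

  -- The last coefficient p (exponent k) is read
  -- off at the words y^k u, u ∈ 𝔥⁰, where the other terms vanish and p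
  -- contributes k!·⟨p⟩_u.

  linComb-injective : ∀ n (ps : Vec Poly n) s → AllV InH0 ps → linComb ch ps s ≈ [] → AllV (_≈ []) ps
  linComb-injective zero [] s hps zero-sum ()
  linComb-injective (suc n) ps s hps zero-sum with snocView ps
  ... | snoc xs p = allV-snoc {_≈ []} xs p (linComb-injective n xs s hxs xs-zero) p-zero
    where
    hxs : AllV InH0 xs
    hxs = allV-init {InH0} xs p hps
    hp : InH0 p
    hp = allV-last {InH0} xs p hps
    k : ℕ
    k = s N.+ n
    split : ∀ t → coeff (linComb ch xs s) t + coeff (mul ch p (ypow ch k)) t ≡ 0ℚ
    split t = trans (sym (coeff-linComb-snoc xs p s t)) (zero-sum t)
    p-zero : p ≈ []
    p-zero u with h0? u
    ... | no ¬hu = InH0-coeff≡0 p u hp ¬hu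
    ... | yes hu = *-zero-cancelˡ (factℚ k) (coeff p u) leading (factℚ≢0 k)
      where
      t : Word
      t = Y^ k ++ u
      leading : factℚ k * coeff p u ≡ 0ℚ
      leading = begin
        factℚ k * coeff p u                           ≡⟨ cong (factℚ k *_) (coeff-as-pairing p u) ⟩
        factℚ k * pairing (indicator u) p             ≡⟨ sym (pairing-*ˡ (factℚ k) (indicator u) p) ⟩
        pairing (λ w → factℚ k * indicator u w) p     ≡⟨ sym (pairing-agree-InH0 (basisCoeff k t) _ p hp (λ hw → basisCoeff-diagonal k hw hu)) ⟩
        pairing (basisCoeff k t) p                    ≡⟨ sym (coeff-mul-left p (ypow ch k) t) ⟩
        coeff (mul ch p (ypow ch k)) t                ≡⟨ sym (ℚP.+-identityˡ _) ⟩
        0ℚ + coeff (mul ch p (ypow ch k)) t           ≡⟨ cong (_+ coeff (mul ch p (ypow ch k)) t) (sym (coeff-linComb-below xs s (height-Y^ k hu) ℕP.≤-refl hxs)) ⟩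
        coeff (linComb ch xs s) t + coeff (mul ch p (ypow ch k)) t ≡⟨ split t ⟩
        0ℚ                                            ∎
    xs-zero : linComb ch xs s ≈ []
    xs-zero t = begin
      coeff (linComb ch xs s) t                                    ≡⟨ sym (ℚP.+-identityʳ _) ⟩
      coeff (linComb ch xs s) t + 0ℚ                               ≡⟨ cong (coeff (linComb ch xs s) t +_) (sym p-term) ⟩
      coeff (linComb ch xs s) t + coeff (mul ch p (ypow ch k)) t   ≡⟨ split t ⟩
      0ℚ                                                           ∎
      where
      p-term : coeff (mul ch p (ypow ch k)) t ≡ 0ℚ
      p-term = trans (coeff-mul-left p (ypow ch k) t) (pairing-vanishes _ p (λ w → inj₁ (p-zero w)))

  InH0-[] : InH0 []
  InH0-[] u 0≢0 = ⊥-elim (0≢0 refl)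

  InH0-⊕ : ∀ p q → InH0 p → InH0 q → InH0 (p ⊕ q)
  InH0-⊕ p q hp hq u ne with coeff p u ℚP.≟ 0ℚ
  ... | no p≢0 = hp u p≢0
  ... | yes p≡0 = hq u (λ q≡0 → ne (trans (coeff-++ p q u) (trans (cong₂ _+_ p≡0 q≡0) (ℚP.+-identityˡ 0ℚ))))

  InH0-scale : ∀ a p → InH0 p → InH0 (scale a p)
  InH0-scale a p hp u ne = hp u (λ p≡0 → ne (trans (coeff-scale a p u) (trans (cong (a *_) p≡0) (ℚP.*-zeroʳ a))))

  InH0-word : ∀ {w} → H0 w → InH0 (word w)
  InH0-word {w} hw u ne = by-cases (w ≟W u)
    where
    by-cases : Dec (w ≡ u) → IsH0Word u
    by-cases (yes refl) = H0→IsH0Word hw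
    by-cases (no w≢u) = ⊥-elim (ne (coeff-word-≢ w≢u))

  linComb-⊕ : ∀ {n} (a b : Vec Poly n) s → linComb ch (zipWith _⊕_ a b) s ≈ linComb ch a s ⊕ linComb ch b s
  linComb-⊕ [] [] s t = refl
  linComb-⊕ (p ∷ a) (q ∷ b) s t = begin
    coeff (linComb ch (zipWith _⊕_ (p ∷ a) (q ∷ b)) s) t
      ≡⟨ coeff-linComb-cons (p ⊕ q) (zipWith _⊕_ a b) s t ⟩
    coeff (mul ch (p ⊕ q) (ypow ch s)) t + coeff (linComb ch (zipWith _⊕_ a b) (suc s)) t
      ≡⟨ cong₂ _+_ (coeff-mul-⊕ p q (ypow ch s) t) (trans (linComb-⊕ a b (suc s) t) (coeff-++ (linComb ch a (suc s)) (linComb ch b (suc s)) t)) ⟩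
    (P + Q) + (A + B)
      ≡⟨ solve 4 (λ P Q A B → (P :+ Q) :+ (A :+ B) := (P :+ A) :+ (Q :+ B)) refl P Q A B ⟩
    (P + A) + (Q + B)
      ≡⟨ sym (cong₂ _+_ (coeff-linComb-cons p a s t) (coeff-linComb-cons q b s t)) ⟩
    coeff (linComb ch (p ∷ a) s) t + coeff (linComb ch (q ∷ b) s) t
      ≡⟨ sym (coeff-++ (linComb ch (p ∷ a) s) (linComb ch (q ∷ b) s) t) ⟩
    coeff (linComb ch (p ∷ a) s ⊕ linComb ch (q ∷ b) s) t ∎
    where
    P Q A B : ℚ
    P = coeff (mul ch p (ypow ch s)) t
    Q = coeff (mul ch q (ypow ch s)) t
    A = coeff (linComb ch a (suc s)) t
    B = coeff (linComb ch b (suc s)) t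

  linComb-scale : ∀ {n} c (a : Vec Poly n) s → linComb ch (V.map (scale c) a) s ≈ scale c (linComb ch a s)
  linComb-scale c [] s t = refl
  linComb-scale c (p ∷ a) s t = begin
    coeff (linComb ch (V.map (scale c) (p ∷ a)) s) t
      ≡⟨ coeff-linComb-cons (scale c p) (V.map (scale c) a) s t ⟩
    coeff (mul ch (scale c p) (ypow ch s)) t + coeff (linComb ch (V.map (scale c) a) (suc s)) t
      ≡⟨ cong₂ _+_ (coeff-mul-scale c p (ypow ch s) t) (trans (linComb-scale c a (suc s) t) (coeff-scale c (linComb ch a (suc s)) t)) ⟩
    c * coeff (mul ch p (ypow ch s)) t + c * coeff (linComb ch a (suc s)) t
      ≡⟨ sym (ℚP.*-distribˡ-+ c _ _) ⟩
    c * (coeff (mul ch p (ypow ch s)) t + coeff (linComb ch a (suc s)) t)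
      ≡⟨ cong (c *_) (sym (coeff-linComb-cons p a s t)) ⟩
    c * coeff (linComb ch (p ∷ a) s) t
      ≡⟨ sym (coeff-scale c (linComb ch (p ∷ a) s) t) ⟩
    coeff (scale c (linComb ch (p ∷ a) s)) t ∎

  linComb-zeros : ∀ n s → linComb ch (V.replicate n []) s ≈ []
  linComb-zeros zero s t = refl
  linComb-zeros (suc n) s t = trans (coeff-linComb-cons [] (V.replicate n []) s t)
                                    (trans (ℚP.+-identityˡ _) (linComb-zeros n (suc s) t))

  linComb-pad : ∀ {n} (a : Vec Poly n) s → linComb ch (a ∷ʳ []) s ≈ linComb ch a s
  linComb-pad a s t = trans (coeff-linComb-snoc a [] s t) (ℚP.+-identityʳ _)

  -- Such polynomials form a subspace containing every word of height ≤ m,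
  -- by induction on m: for t₀ = y^{m+1} u,
  --   u ∘̄ y^{∘̄(m+1)} = (m+1)!·t₀ + R   with R of height ≤ m,
  -- so t₀ = ((m+1)!)⁻¹·(u ∘̄ y^{∘̄(m+1)} - R).

  HasExpansion : ℕ → Poly → Set
  HasExpansion m p = Σ (Vec Poly (suc m)) λ ws → AllV InH0 ws × p ≈ expansion ch ws

  hasExpansion-≈ : ∀ {m} p q → p ≈ q → HasExpansion m q → HasExpansion m p
  hasExpansion-≈ p q p≈q (ws , hws , q≈) = ws , hws , λ t → trans (p≈q t) (q≈ t)

  allV-[] : ∀ n → AllV InH0 (V.replicate n [])
  allV-[] (suc n) zero = InH0-[]
  allV-[] (suc n) (suc i) = allV-[] n i

  hasExpansion-[] : ∀ m → HasExpansion m []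
  hasExpansion-[] m = V.replicate (suc m) [] , allV-[] (suc m) , λ t → sym (linComb-zeros (suc m) 0 t)

  hasExpansion-⊕ : ∀ {m} p q → HasExpansion m p → HasExpansion m q → HasExpansion m (p ⊕ q)
  hasExpansion-⊕ p q (a , ha , p≈) (b , hb , q≈) = zipWith _⊕_ a b , hab , sum≈
    where
    hab : AllV InH0 (zipWith _⊕_ a b)
    hab i rewrite VP.lookup-zipWith _⊕_ i a b = InH0-⊕ (lookup a i) (lookup b i) (ha i) (hb i)
    sum≈ : p ⊕ q ≈ expansion ch (zipWith _⊕_ a b)
    sum≈ t = begin
      coeff (p ⊕ q) t                                            ≡⟨ coeff-++ p q t ⟩
      coeff p t + coeff q t                                      ≡⟨ cong₂ _+_ (p≈ t) (q≈ t) ⟩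
      coeff (expansion ch a) t + coeff (expansion ch b) t        ≡⟨ sym (coeff-++ (expansion ch a) (expansion ch b) t) ⟩
      coeff (expansion ch a ⊕ expansion ch b) t                  ≡⟨ sym (linComb-⊕ a b 0 t) ⟩
      coeff (expansion ch (zipWith _⊕_ a b)) t                   ∎

  hasExpansion-scale : ∀ {m} c p → HasExpansion m p → HasExpansion m (scale c p)
  hasExpansion-scale c p (a , ha , p≈) = V.map (scale c) a , hca , scaled≈
    where
    hca : AllV InH0 (V.map (scale c) a)
    hca i rewrite VP.lookup-map i (scale c) a = InH0-scale c (lookup a i) (ha i)
    scaled≈ : scale c p ≈ expansion ch (V.map (scale c) a)
    scaled≈ t = begin
      coeff (scale c p) t                          ≡⟨ coeff-scale c p t ⟩
      c * coeff p t                                ≡⟨ cong (c *_) (p≈ t) ⟩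
      c * coeff (expansion ch a) t                 ≡⟨ sym (coeff-scale c (expansion ch a) t) ⟩
      coeff (scale c (expansion ch a)) t           ≡⟨ sym (linComb-scale c a 0 t) ⟩
      coeff (expansion ch (V.map (scale c) a)) t   ∎

  hasExpansion-pad : ∀ {m} p → HasExpansion m p → HasExpansion (suc m) p
  hasExpansion-pad p (a , ha , p≈) =
    a ∷ʳ [] , allV-snoc {InH0} a [] ha InH0-[] , λ t → trans (p≈ t) (sym (linComb-pad a 0 t))

  hasExpansion-supported : ∀ {m} → (∀ {v} → Height≤ m v → HasExpansion m (word v)) →
    ∀ p → Supported (Height≤ m) p → HasExpansion m p
  hasExpansion-supported {m} words [] [] = hasExpansion-[] m
  hasExpansion-supported words ((c , v) ∷ p) (inj₁ refl ∷ sp) =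
    hasExpansion-≈ ((0ℚ , v) ∷ p) p drop-zero (hasExpansion-supported words p sp)
    where
    drop-zero : (0ℚ , v) ∷ p ≈ p
    drop-zero t = trans (coeff-cons 0ℚ v p t) (trans (cong (_+ coeff p t) (ℚP.*-zeroˡ (indicator t v))) (ℚP.+-identityˡ (coeff p t)))
  hasExpansion-supported words ((c , v) ∷ p) (inj₂ hv ∷ sp) =
    hasExpansion-≈ ((c , v) ∷ p) (scale c (word v) ⊕ p) split
      (hasExpansion-⊕ (scale c (word v)) p (hasExpansion-scale c (word v) (words hv)) (hasExpansion-supported words p sp))
    where
    split : (c , v) ∷ p ≈ scale c (word v) ⊕ p
    split t = begin
      coeff ((c , v) ∷ p) t                  ≡⟨ coeff-cons c v p t ⟩
      c * indicator t v + coeff p t          ≡⟨ cong (λ z → c * z + coeff p t) (sym (coeff-word v t)) ⟩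
      c * coeff (word v) t + coeff p t       ≡⟨ cong (_+ coeff p t) (sym (coeff-scale c (word v) t)) ⟩
      coeff (scale c (word v)) t + coeff p t ≡⟨ sym (coeff-++ (scale c (word v)) p t) ⟩
      coeff (scale c (word v) ⊕ p) t         ∎

  hasExpansion-monomial : ∀ n p → InH0 p → HasExpansion n (mul ch p (ypow ch n))
  hasExpansion-monomial n p hp = top , all-h0 , λ t → sym (begin
    coeff (expansion ch top) t                               ≡⟨ coeff-linComb-snoc zeros p 0 t ⟩
    coeff (expansion ch zeros) t + coeff (mul ch p (ypow ch n)) t
                                                             ≡⟨ cong (_+ coeff (mul ch p (ypow ch n)) t) (linComb-zeros n 0 t) ⟩
    0ℚ + coeff (mul ch p (ypow ch n)) t                      ≡⟨ ℚP.+-identityˡ _ ⟩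
    coeff (mul ch p (ypow ch n)) t                           ∎)
    where
    zeros top : Vec Poly _
    zeros = V.replicate n []
    top = zeros ∷ʳ p
    all-h0 : AllV InH0 top
    all-h0 = allV-snoc {InH0} zeros p (allV-[] n) hp

  hasExpansion-h0 : ∀ {u} → H0 u → HasExpansion 0 (word u)
  hasExpansion-h0 {u} hu = hasExpansion-≈ (word u) P (λ t → sym (by-cases t (u ≟W t)))
                             (hasExpansion-monomial 0 (word u) (InH0-word hu))
    where
    P : Poly
    P = mul ch (word u) (ypow ch 0)
    by-cases : ∀ t → Dec (u ≡ t) → coeff P t ≡ coeff (word u) t
    by-cases t (yes refl) = trans (proj₂ (h0-times-ypow 0 hu)) (sym (coeff-word-≡ u))
    by-cases t (no u≢t) = trans (supported-coeff≡0 P t (proj₁ (h0-times-ypow 0 hu)) not-there) (sym (coeff-word-≢ u≢t))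
      where
      not-there : ¬ (t ≡ u ⊎ Height< 0 t)
      not-there (inj₁ refl) = u≢t refl
      not-there (inj₂ (_ , () , _))

  hasExpansion-top : ∀ m → (∀ {v} → Height≤ m v → HasExpansion m (word v)) →
    ∀ {u} → H0 u → HasExpansion (suc m) (word (Y^ (suc m) ++ u))
  hasExpansion-top m words {u} hu =
    hasExpansion-≈ (word t₀) (scale (1/ coeff P t₀) (P ⊕ scale (- 1ℚ) R)) (isolate-word P t₀)
      (hasExpansion-scale (1/ coeff P t₀) (P ⊕ scale (- 1ℚ) R)
        (hasExpansion-⊕ P (scale (- 1ℚ) R) (hasExpansion-monomial (suc m) (word u) (InH0-word hu))
          (hasExpansion-scale (- 1ℚ) R (hasExpansion-pad R R-exp))))
    where
    t₀ : Word
    t₀ = Y^ (suc m) ++ u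
    P R : Poly
    P = mul ch (word u) (ypow ch (suc m))
    R = remove t₀ P
    instance
      leading≠0 : NonZero (coeff P t₀)
      leading≠0 = ≢-nonZero (λ e → factℚ≢0 (suc m) (trans (sym (proj₂ (h0-times-ypow (suc m) hu))) e))
    R-exp : HasExpansion m R
    R-exp = hasExpansion-supported words R
      (supported-mono (λ { (j , j<m+1 , hj) → j , ℕP.≤-pred j<m+1 , hj }) R
        (supported-remove t₀ P (proj₁ (h0-times-ypow (suc m) hu))))

  word-hasExpansion : ∀ m {v} → Height≤ m v → HasExpansion m (word v)
  word-hasExpansion zero (zero , z≤n , height0 hv) = hasExpansion-h0 hv
  word-hasExpansion (suc m) {v} (j , j≤m+1 , hv) with j N.≟ suc m
  ... | no j≢m+1 = hasExpansion-pad (word v) (word-hasExpansion m (j , ℕP.≤-pred (ℕP.≤∧≢⇒< j≤m+1 j≢m+1) , hv))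
  ... | yes refl with height-split hv
  ...   | u , hu , refl = hasExpansion-top m (word-hasExpansion m) hu

  expansion-unique : ∀ {m} (ws ws′ : Vec Poly (suc m)) → AllV InH0 ws → AllV InH0 ws′ →
    expansion ch ws ≈ expansion ch ws′ → ∀ i → lookup ws′ i ≈ lookup ws i
  expansion-unique {m} ws ws′ hws hws′ same i u = difference-zero _ _ (begin
    coeff a u + - coeff b u                   ≡⟨ cong (coeff a u +_) (minus-one (coeff b u)) ⟩
    coeff a u + - 1ℚ * coeff b u              ≡⟨ cong (coeff a u +_) (sym (coeff-scale (- 1ℚ) b u)) ⟩
    coeff a u + coeff (scale (- 1ℚ) b) u      ≡⟨ sym (coeff-++ a (scale (- 1ℚ) b) u) ⟩
    coeff (a ⊕ scale (- 1ℚ) b) u              ≡⟨ cong (λ r → coeff r u) (sym d-entry) ⟩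
    coeff (lookup d i) u                      ≡⟨ linComb-injective (suc m) d 0 hd d-zero i u ⟩
    0ℚ                                        ∎)
    where
    a b : Poly
    a = lookup ws′ i
    b = lookup ws i
    minus-one : ∀ x → - x ≡ - 1ℚ * x
    minus-one = solve 1 (λ x → :- x := :- con 1ℚ :* x) refl
    diff : HasExpansion m (expansion ch ws′ ⊕ scale (- 1ℚ) (expansion ch ws))
    diff = hasExpansion-⊕ (expansion ch ws′) (scale (- 1ℚ) (expansion ch ws)) (ws′ , hws′ , λ _ → refl)
             (hasExpansion-scale (- 1ℚ) (expansion ch ws) (ws , hws , λ _ → refl))
    d : Vec Poly (suc m)
    d = proj₁ diff
    hd : AllV InH0 d
    hd = proj₁ (proj₂ diff)
    d-zero : linComb ch d 0 ≈ []
    d-zero t = begin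
      coeff (expansion ch d) t                                               ≡⟨ sym (proj₂ (proj₂ diff) t) ⟩
      coeff (expansion ch ws′ ⊕ scale (- 1ℚ) (expansion ch ws)) t           ≡⟨ coeff-++ (expansion ch ws′) _ t ⟩
      coeff (expansion ch ws′) t + coeff (scale (- 1ℚ) (expansion ch ws)) t ≡⟨ cong₂ _+_ (sym (same t)) (coeff-scale (- 1ℚ) (expansion ch ws) t) ⟩
      e + - 1ℚ * e                                                           ≡⟨ solve 1 (λ e → e :+ :- con 1ℚ :* e := con 0ℚ) refl e ⟩
      0ℚ                                                                     ∎
      where
      e : ℚ
      e = coeff (expansion ch ws) t
    d-entry : lookup d i ≡ a ⊕ scale (- 1ℚ) b
    d-entry = trans (VP.lookup-zipWith _⊕_ i ws′ _) (cong (a ⊕_) (VP.lookup-map i (scale (- 1ℚ)) ws))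

supported-nshuf : ∀ {P} u1 w1 u2 w2 →
  Supported P (prefix (u1 ∷ []) (nshuf w1 (u2 ∷ w2))) →
  Supported P (prefix (u2 ∷ []) (nshuf (u1 ∷ w1) w2)) →
  Supported P (scale (δ w1) (word (τ u1 ∷ u2 ∷ w2))) →
  Supported P (scale (δ w2) (word (τ u2 ∷ u1 ∷ w1))) →
  Supported P (nshuf (u1 ∷ w1) (u2 ∷ w2))
supported-nshuf u1 w1 u2 w2 s₁ s₂ s₃ s₄ =
  supported-++ (A ++ B) (neg (C ++ D)) (supported-++ A B s₁ s₂) (supported-neg (C ++ D) (supported-++ C D s₃ s₄))
  where
  A B C D : Poly
  A = prefix (u1 ∷ []) (nshuf w1 (u2 ∷ w2))
  B = prefix (u2 ∷ []) (nshuf (u1 ∷ w1) w2)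
  C = scale (δ w1) (word (τ u1 ∷ u2 ∷ w2))
  D = scale (δ w2) (word (τ u2 ∷ u1 ∷ w1))

coeff-nshuf : ∀ u1 w1 u2 w2 t {a b c d} →
  coeff (prefix (u1 ∷ []) (nshuf w1 (u2 ∷ w2))) t ≡ a →
  coeff (prefix (u2 ∷ []) (nshuf (u1 ∷ w1) w2)) t ≡ b →
  δ w1 * coeff (word (τ u1 ∷ u2 ∷ w2)) t ≡ c →
  δ w2 * coeff (word (τ u2 ∷ u1 ∷ w1)) t ≡ d →
  coeff (nshuf (u1 ∷ w1) (u2 ∷ w2)) t ≡ (a + b) + - (c + d)
coeff-nshuf u1 w1 u2 w2 t refl refl refl refl = begin
  coeff ((A ⊕ B) ⊖ (C ⊕ D)) t              ≡⟨ coeff-⊖ (A ++ B) (C ++ D) t ⟩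
  coeff (A ++ B) t + - coeff (C ++ D) t    ≡⟨ cong₂ (λ l r → l + - r) (coeff-++ A B t) (coeff-++ C D t) ⟩
  (coeff A t + coeff B t) + - (coeff C t + coeff D t)
                                           ≡⟨ cong (λ r → (coeff A t + coeff B t) + - r)
                                                   (cong₂ _+_ (coeff-scale (δ w1) (word (τ u1 ∷ u2 ∷ w2)) t) (coeff-scale (δ w2) (word (τ u2 ∷ u1 ∷ w1)) t)) ⟩
  (coeff A t + coeff B t) + - (δ w1 * coeff (word (τ u1 ∷ u2 ∷ w2)) t + δ w2 * coeff (word (τ u2 ∷ u1 ∷ w1)) t) ∎
  where
  A B C D : Poly
  A = prefix (u1 ∷ []) (nshuf w1 (u2 ∷ w2))
  B = prefix (u2 ∷ []) (nshuf (u1 ∷ w1) w2)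
  C = scale (δ w1) (word (τ u1 ∷ u2 ∷ w2))
  D = scale (δ w2) (word (τ u2 ∷ u1 ∷ w1))

supported-scaled-word : ∀ {P : Word → Set} a v → P v → Supported P (scale a (word v))
supported-scaled-word a v pv = supported-scale a (word v) (supported-word v pv)

prefix-endsInY : ∀ {P : Word → Set} a p → (∀ {v} → EndsInY v → P (a ∷ v)) → Supported EndsInY p → Supported P (prefix (a ∷ []) p)
prefix-endsInY a p f sp = supported-prefix a p (supported-mono f p sp)

nshuf-endsInY : ∀ {a b} → EndsInY a → EndsInY b → Supported EndsInY (nshuf a b)
nshuf-endsInY just-y just-y =
  supported-nshuf y [] y []
    (prefix-endsInY y (nshuf [] (y ∷ [])) (extend y) (supported-word _ just-y))
    (prefix-endsInY y (nshuf (y ∷ []) []) (extend y) (supported-word _ just-y))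
    (supported-scaled-word (δ []) (x ∷ y ∷ []) (extend x just-y))
    (supported-scaled-word (δ []) (x ∷ y ∷ []) (extend x just-y))
nshuf-endsInY just-y (extend u2 {w2} e2) =
  supported-nshuf y [] u2 w2
    (prefix-endsInY y (nshuf [] (u2 ∷ w2)) (extend y) (supported-word _ (extend u2 e2)))
    (prefix-endsInY u2 (nshuf (y ∷ []) w2) (extend u2) (nshuf-endsInY just-y e2))
    (supported-scaled-word (δ []) (x ∷ u2 ∷ w2) (extend x (extend u2 e2)))
    (supported-scaled-word (δ w2) (τ u2 ∷ y ∷ []) (extend (τ u2) just-y))
nshuf-endsInY (extend u1 {w1} e1) just-y =
  supported-nshuf u1 w1 y []
    (prefix-endsInY u1 (nshuf w1 (y ∷ [])) (extend u1) (nshuf-endsInY e1 just-y))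
    (prefix-endsInY y (nshuf (u1 ∷ w1) []) (extend y) (supported-word _ (extend u1 e1)))
    (supported-scaled-word (δ w1) (τ u1 ∷ y ∷ []) (extend (τ u1) just-y))
    (supported-scaled-word (δ []) (x ∷ u1 ∷ w1) (extend x (extend u1 e1)))
nshuf-endsInY (extend u1 {w1} e1) (extend u2 {w2} e2) =
  supported-nshuf u1 w1 u2 w2
    (prefix-endsInY u1 (nshuf w1 (u2 ∷ w2)) (extend u1) (nshuf-endsInY e1 (extend u2 e2)))
    (prefix-endsInY u2 (nshuf (u1 ∷ w1) w2) (extend u2) (nshuf-endsInY (extend u1 e1) e2))
    (supported-scaled-word (δ w1) (τ u1 ∷ u2 ∷ w2) (extend (τ u1) (extend u2 e2)))
    (supported-scaled-word (δ w2) (τ u2 ∷ u1 ∷ w1) (extend (τ u2) (extend u1 e1)))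

prefix-y-height≤ : ∀ {k} p → Supported (Height≤ k) p → Supported (Height≤ (suc k)) (prefix (y ∷ []) p)
prefix-y-height≤ p sp = supported-prefix y p (supported-mono height≤-y p sp)

prefix-x-height≤ : ∀ {k} p → Supported EndsInY p → Supported (Height≤ k) (prefix (x ∷ []) p)
prefix-x-height≤ p sp = prefix-endsInY x p (λ e → height≤-h0 (h0-x e)) sp

nshuf-height : ∀ {p q a b} → Height p a → Height q b → Supported (Height≤ (p N.+ q)) (nshuf a b)
nshuf-height {q = q} (height0 h0-empty) hb = supported-word _ (q , ℕP.≤-refl , hb)
nshuf-height (height0 (h0-x e)) (height0 h0-empty) = supported-word _ (0 , z≤n , height0 (h0-x e))
nshuf-height {suc p} (heightS ha) (height0 h0-empty) = supported-word _ (suc p , ℕP.m≤m+n (suc p) 0 , heightS ha)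
nshuf-height (height0 (h0-x {w1} e1)) (height0 (h0-x {w2} e2)) =
  supported-nshuf x w1 x w2
    (prefix-x-height≤ (nshuf w1 (x ∷ w2)) (nshuf-endsInY e1 (extend x e2)))
    (prefix-x-height≤ (nshuf (x ∷ w1) w2) (nshuf-endsInY (extend x e1) e2))
    (supported-scale-0 (word (y ∷ x ∷ w2)) (δ-endsInY e1))
    (supported-scale-0 (word (y ∷ x ∷ w1)) (δ-endsInY e2))
nshuf-height {q = suc q} (height0 (h0-x {w1} e1)) (heightS {w = w2} hb) =
  supported-nshuf x w1 y w2
    (prefix-x-height≤ (nshuf w1 (y ∷ w2)) (nshuf-endsInY e1 (height-endsInY hb)))
    (prefix-y-height≤ (nshuf (x ∷ w1) w2) (nshuf-height (height0 (h0-x e1)) hb))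
    (supported-scale-0 (word (y ∷ y ∷ w2)) (δ-endsInY e1))
    (supported-scaled-word (δ w2) (x ∷ x ∷ w1) (height≤-h0 (h0-x (extend x e1))))
nshuf-height {suc p} (heightS {w = w1} ha) (height0 (h0-x {w2} e2)) =
  supported-nshuf y w1 x w2
    (prefix-y-height≤ (nshuf w1 (x ∷ w2)) (nshuf-height ha (height0 (h0-x e2))))
    (prefix-x-height≤ (nshuf (y ∷ w1) w2) (nshuf-endsInY (height-endsInY ha) e2))
    (supported-scaled-word (δ w1) (x ∷ x ∷ w2) (height≤-h0 (h0-x (extend x e2))))
    (supported-scale-0 (word (y ∷ y ∷ w1)) (δ-endsInY e2))
nshuf-height {suc p} {suc q} (heightS {w = w1} ha) (heightS {w = w2} hb) =
  supported-nshuf y w1 y w2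
    (prefix-y-height≤ (nshuf w1 (y ∷ w2)) (nshuf-height ha (heightS hb)))
    (subst (λ k → Supported (Height≤ (suc k)) (prefix (y ∷ []) (nshuf (y ∷ w1) w2))) (sym (ℕP.+-suc p q))
           (prefix-y-height≤ (nshuf (y ∷ w1) w2) (nshuf-height (heightS ha) hb)))
    (supported-scaled-word (δ w1) (x ∷ y ∷ w2) (height≤-h0 (h0-x (height-endsInY hb))))
    (supported-scaled-word (δ w2) (x ∷ y ∷ w1) (height≤-h0 (h0-x (height-endsInY ha))))

nshuf-times-y : ∀ {j a} → Height j a →
  Supported (λ v → v ≡ y ∷ a ⊎ Height≤ j v) (nshuf a (y ∷ [])) × coeff (nshuf a (y ∷ [])) (y ∷ a) ≡ natℚ (suc j)
nshuf-times-y (height0 h0-empty) = supported-word _ (inj₁ refl) , trans (coeff-word-≡ (y ∷ [])) (sym (ℚP.+-identityʳ 1ℚ))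
nshuf-times-y (height0 (h0-x {w} e)) =
  supported-nshuf x w y []
    (prefix-endsInY x (nshuf w (y ∷ [])) (λ ev → inj₂ (height≤-h0 (h0-x ev))) (nshuf-endsInY e just-y))
    (supported-prefix y (word (x ∷ w)) (supported-word _ (inj₁ refl)))
    (supported-scale-0 (word (y ∷ y ∷ [])) (δ-endsInY e))
    (supported-scaled-word (δ []) (x ∷ x ∷ w) (inj₂ (height≤-h0 (h0-x (extend x e))))) ,
  coeff-nshuf x w y [] (y ∷ x ∷ w)
    (coeff-prefix-≢ (nshuf w (y ∷ [])) (x ∷ w) (λ ()))
    (trans (coeff-prefix-≡ y (word (x ∷ w)) (x ∷ w)) (coeff-word-≡ (x ∷ w)))
    (trans (cong (_* coeff (word (y ∷ y ∷ [])) (y ∷ x ∷ w)) (δ-endsInY e)) (ℚP.*-zeroˡ (coeff (word (y ∷ y ∷ [])) (y ∷ x ∷ w))))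
    (trans (cong (δ [] *_) (coeff-word-≢ {x ∷ x ∷ w} {y ∷ x ∷ w} (λ ()))) (ℚP.*-zeroʳ (δ [])))
nshuf-times-y (heightS {j} {a} h) =
  supported-nshuf y a y []
    (supported-prefix y (nshuf a (y ∷ [])) (supported-mono lift (nshuf a (y ∷ [])) (proj₁ (nshuf-times-y h))))
    (supported-prefix y (word (y ∷ a)) (supported-word _ (inj₁ refl)))
    (supported-scaled-word (δ a) (x ∷ y ∷ []) (inj₂ (height≤-h0 (h0-x just-y))))
    (supported-scaled-word (δ []) (x ∷ y ∷ a) (inj₂ (height≤-h0 (h0-x (height-endsInY h))))) ,
  trans (coeff-nshuf y a y [] (y ∷ y ∷ a)
           (trans (coeff-prefix-≡ y (nshuf a (y ∷ [])) (y ∷ a)) (proj₂ (nshuf-times-y h)))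
           (trans (coeff-prefix-≡ y (word (y ∷ a)) (y ∷ a)) (coeff-word-≡ (y ∷ a)))
           (trans (cong (δ a *_) (coeff-word-≢ {x ∷ y ∷ []} {y ∷ y ∷ a} (λ ()))) (ℚP.*-zeroʳ (δ a)))
           (trans (cong (δ [] *_) (coeff-word-≢ {x ∷ y ∷ a} {y ∷ y ∷ a} (λ ()))) (ℚP.*-zeroʳ (δ []))))
        (solve 1 (λ n → (n :+ con 1ℚ) :+ :- (con 0ℚ :+ con 0ℚ) := con 1ℚ :+ n) refl (natℚ (suc j)))
  where
  lift : ∀ {v} → v ≡ y ∷ a ⊎ Height≤ j v → y ∷ v ≡ y ∷ y ∷ a ⊎ Height≤ (suc j) (y ∷ v)
  lift (inj₁ refl) = inj₁ refl
  lift (inj₂ l) = inj₂ (height≤-y l)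

nshuf-h0-times-Y^ : ∀ j {h} → H0 h →
  Supported (λ v → v ≡ Y^ j ++ h ⊎ Height< j v) (nshuf h (Y^ j)) × coeff (nshuf h (Y^ j)) (Y^ j ++ h) ≡ 1ℚ
nshuf-h0-times-Y^ j h0-empty =
  supported-word _ (inj₁ (sym (++-identityʳ (Y^ j)))) ,
  subst (λ z → coeff (word (Y^ j)) z ≡ 1ℚ) (sym (++-identityʳ (Y^ j))) (coeff-word-≡ (Y^ j))
nshuf-h0-times-Y^ zero (h0-x {w} e) = supported-word _ (inj₁ refl) , coeff-word-≡ (x ∷ w)
nshuf-h0-times-Y^ (suc j) (h0-x {w} e) =
  supported-nshuf x w y (Y^ j)
    (prefix-endsInY x (nshuf w (y ∷ Y^ j)) (λ ev → inj₂ (height<-h0 (h0-x ev))) (nshuf-endsInY e (endsInY-Y^ j)))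
    (supported-prefix y (nshuf (x ∷ w) (Y^ j)) (supported-mono lift (nshuf (x ∷ w) (Y^ j)) (proj₁ IH)))
    (supported-scale-0 (word (y ∷ y ∷ Y^ j)) (δ-endsInY e))
    (supported-scaled-word (δ (Y^ j)) (x ∷ x ∷ w) (inj₂ (height<-h0 (h0-x (extend x e))))) ,
  coeff-nshuf x w y (Y^ j) t
    (coeff-prefix-≢ (nshuf w (y ∷ Y^ j)) (Y^ j ++ x ∷ w) (λ ()))
    (trans (coeff-prefix-≡ y (nshuf (x ∷ w) (Y^ j)) (Y^ j ++ x ∷ w)) (proj₂ IH))
    (trans (cong (_* coeff (word (y ∷ y ∷ Y^ j)) t) (δ-endsInY e)) (ℚP.*-zeroˡ (coeff (word (y ∷ y ∷ Y^ j)) t)))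
    (trans (cong (δ (Y^ j) *_) (coeff-word-≢ {x ∷ x ∷ w} {t} (λ ()))) (ℚP.*-zeroʳ (δ (Y^ j))))
  where
  t : Word
  t = y ∷ (Y^ j ++ x ∷ w)
  IH : Supported (λ v → v ≡ Y^ j ++ x ∷ w ⊎ Height< j v) (nshuf (x ∷ w) (Y^ j)) × coeff (nshuf (x ∷ w) (Y^ j)) (Y^ j ++ x ∷ w) ≡ 1ℚ
  IH = nshuf-h0-times-Y^ j (h0-x e)
  lift : ∀ {v} → v ≡ Y^ j ++ x ∷ w ⊎ Height< j v → y ∷ v ≡ t ⊎ Height< (suc j) (y ∷ v)
  lift (inj₁ refl) = inj₁ refl
  lift (inj₂ l) = inj₂ (height<-y l)

shuffle-triangular : Triangular shuffle
shuffle-triangular = record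
  { times-y = nshuf-times-y
  ; h0-times-Y^ = nshuf-h0-times-Y^
  ; h0-times-height = λ hh hb → nshuf-height (height0 hh) hb
  }

-- It is defined on the encoding
-- z_{k₁}⋯z_{kₙ} ↦ [k₁-1, …, kₙ-1] (a list of naturals, "z-word"); the
-- three bounds are proved there and transported along the injective fromZ.

ZWord : Set
ZWord = List ℕ

zterm : ZWord → ℚ × ZWord → ℚ
zterm t (c , v) with ≡-dec ℕP._≟_ v t
... | yes _ = c
... | no _ = 0ℚ

zcoeff : ZPoly → ZWord → ℚ
zcoeff [] t = 0ℚ
zcoeff (e ∷ zp) t = zterm t e + zcoeff zp t

zterm-≡ : ∀ c v → zterm v (c , v) ≡ c
zterm-≡ c v with ≡-dec ℕP._≟_ v v
... | yes _ = refl
... | no v≢v = ⊥-elim (v≢v refl)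

zterm-≢ : ∀ c {v t} → v ≢ t → zterm t (c , v) ≡ 0ℚ
zterm-≢ c {v} {t} v≢t with ≡-dec ℕP._≟_ v t
... | yes v≡t = ⊥-elim (v≢t v≡t)
... | no _ = refl

zterm-∷ : ∀ k c v t → zterm (k ∷ t) (c , k ∷ v) ≡ zterm t (c , v)
zterm-∷ k c v t = by-cases (≡-dec ℕP._≟_ v t)
  where
  by-cases : Dec (v ≡ t) → zterm (k ∷ t) (c , k ∷ v) ≡ zterm t (c , v)
  by-cases (yes refl) = trans (zterm-≡ c (k ∷ v)) (sym (zterm-≡ c v))
  by-cases (no v≢t) = trans (zterm-≢ c {k ∷ v} {k ∷ t} (λ e → v≢t (∷-injectiveʳ e))) (sym (zterm-≢ c v≢t))

zcoeff-++ : ∀ p q t → zcoeff (p ++ q) t ≡ zcoeff p t + zcoeff q t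
zcoeff-++ [] q t = sym (ℚP.+-identityˡ _)
zcoeff-++ (e ∷ p) q t = trans (cong (zterm t e +_) (zcoeff-++ p q t)) (sym (ℚP.+-assoc (zterm t e) _ _))

zcoeff-zcons : ∀ k p t → zcoeff (zcons k p) (k ∷ t) ≡ zcoeff p t
zcoeff-zcons k [] t = refl
zcoeff-zcons k ((c , v) ∷ p) t = cong₂ _+_ (zterm-∷ k c v t) (zcoeff-zcons k p t)

zcoeff-zcons-≢ : ∀ {k k′} p t → k ≢ k′ → zcoeff (zcons k p) (k′ ∷ t) ≡ 0ℚ
zcoeff-zcons-≢ [] t k≢k′ = refl
zcoeff-zcons-≢ ((c , v) ∷ p) t k≢k′ =
  trans (cong₂ _+_ (zterm-≢ c (λ e → k≢k′ (∷-injectiveˡ e))) (zcoeff-zcons-≢ p t k≢k′)) (ℚP.+-identityˡ 0ℚ)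

zcoeff-zneg : ∀ p t → zcoeff (zneg p) t ≡ - zcoeff p t
zcoeff-zneg [] t = refl
zcoeff-zneg ((c , v) ∷ p) t =
  trans (cong₂ _+_ (by-cases (≡-dec ℕP._≟_ v t)) (zcoeff-zneg p t)) (sym (ℚP.neg-distrib-+ (zterm t (c , v)) _))
  where
  by-cases : Dec (v ≡ t) → zterm t (- c , v) ≡ - zterm t (c , v)
  by-cases (yes refl) = trans (zterm-≡ (- c) v) (cong -_ (sym (zterm-≡ c v)))
  by-cases (no v≢t) = trans (zterm-≢ (- c) v≢t) (cong -_ (sym (zterm-≢ c v≢t)))

zcoeff-single : ∀ v → zcoeff ((1ℚ , v) ∷ []) v ≡ 1ℚ
zcoeff-single v = trans (cong (_+ 0ℚ) (zterm-≡ 1ℚ v)) (ℚP.+-identityʳ 1ℚ)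

zcoeff-nharmZ : ∀ a u b v t {p q r} →
  zcoeff (zcons a (nharmZ u (b ∷ v))) t ≡ p →
  zcoeff (zcons b (nharmZ (a ∷ u) v)) t ≡ q →
  zcoeff (zcons (suc (a N.+ b)) (nharmZ u v)) t ≡ r →
  zcoeff (nharmZ (a ∷ u) (b ∷ v)) t ≡ p + (q + - r)
zcoeff-nharmZ a u b v t refl refl refl =
  trans (zcoeff-++ A (B ++ zneg C) t) (cong (zcoeff A t +_) (trans (zcoeff-++ B (zneg C) t) (cong (zcoeff B t +_) (zcoeff-zneg C t))))
  where
  A B C : ZPoly
  A = zcons a (nharmZ u (b ∷ v))
  B = zcons b (nharmZ (a ∷ u) v)
  C = zcons (suc (a N.+ b)) (nharmZ u v)

ZSupported : (ZWord → Set) → ZPoly → Set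
ZSupported P p = All (λ e → proj₁ e ≡ 0ℚ ⊎ P (proj₂ e)) p

zsupported-++ : ∀ {P} p q → ZSupported P p → ZSupported P q → ZSupported P (p ++ q)
zsupported-++ [] q [] sq = sq
zsupported-++ (e ∷ p) q (s ∷ sp) sq = s ∷ zsupported-++ p q sp sq

zsupported-mono : ∀ {P Q : ZWord → Set} → (∀ {v} → P v → Q v) → ∀ p → ZSupported P p → ZSupported Q p
zsupported-mono f p = All.map λ { (inj₁ c≡0) → inj₁ c≡0 ; (inj₂ Pv) → inj₂ (f Pv) }

zsupported-zcons : ∀ {P : ZWord → Set} k p → ZSupported (λ v → P (k ∷ v)) p → ZSupported P (zcons k p)
zsupported-zcons k [] [] = []
zsupported-zcons k (e ∷ p) (s ∷ sp) = s ∷ zsupported-zcons k p sp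

zsupported-zcons-any : ∀ {P : ZWord → Set} k p → (∀ v → P (k ∷ v)) → ZSupported P (zcons k p)
zsupported-zcons-any k [] all-P = []
zsupported-zcons-any k (e ∷ p) all-P = inj₂ (all-P _) ∷ zsupported-zcons-any k p all-P

zsupported-zneg : ∀ {P} p → ZSupported P p → ZSupported P (zneg p)
zsupported-zneg [] [] = []
zsupported-zneg (e ∷ p) (inj₁ c≡0 ∷ sp) = inj₁ (cong -_ c≡0) ∷ zsupported-zneg p sp
zsupported-zneg (e ∷ p) (inj₂ Pv ∷ sp) = inj₂ Pv ∷ zsupported-zneg p sp

zsupported-nharmZ : ∀ {P} a u b v →
  ZSupported P (zcons a (nharmZ u (b ∷ v))) →
  ZSupported P (zcons b (nharmZ (a ∷ u) v)) →
  ZSupported P (zcons (suc (a N.+ b)) (nharmZ u v)) →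
  ZSupported P (nharmZ (a ∷ u) (b ∷ v))
zsupported-nharmZ a u b v sA sB sC =
  zsupported-++ (zcons a (nharmZ u (b ∷ v))) _ sA (zsupported-++ (zcons b (nharmZ (a ∷ u) v)) _ sB (zsupported-zneg _ sC))

-- heights of z-words: y^j h with h ∈ 𝔥⁰ is 0ʲ followed by [] or by a nonzero letter
data ZHeight : ℕ → ZWord → Set where
  zheight0-empty : ZHeight 0 []
  zheight0-x : ∀ {k ks} → ZHeight 0 (suc k ∷ ks)
  zheightS : ∀ {j ks} → ZHeight j ks → ZHeight (suc j) (0 ∷ ks)

ZHeight≤ : ℕ → ZWord → Set
ZHeight≤ k v = Σ ℕ λ j → j N.≤ k × ZHeight j v

ZHeight< : ℕ → ZWord → Set
ZHeight< k v = Σ ℕ λ j → j N.< k × ZHeight j v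

Z^ : ℕ → ZWord
Z^ j = replicate j 0

zheight≤-x : ∀ {n} k v → ZHeight≤ n (suc k ∷ v)
zheight≤-x k v = 0 , z≤n , zheight0-x

zheight≤-0∷ : ∀ {n v} → ZHeight≤ n v → ZHeight≤ (suc n) (0 ∷ v)
zheight≤-0∷ (j , j≤n , h) = suc j , s≤s j≤n , zheightS h

nharmZ-height : ∀ {p q a b} → ZHeight p a → ZHeight q b → ZSupported (ZHeight≤ (p N.+ q)) (nharmZ a b)
nharmZ-height {q = q} zheight0-empty hb = inj₂ (q , ℕP.≤-refl , hb) ∷ []
nharmZ-height zheight0-x zheight0-empty = inj₂ (0 , z≤n , zheight0-x) ∷ []
nharmZ-height {suc p} (zheightS ha) zheight0-empty = inj₂ (suc p , ℕP.m≤m+n (suc p) 0 , zheightS ha) ∷ []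
nharmZ-height (zheight0-x {k} {u}) (zheight0-x {l} {v}) =
  zsupported-nharmZ (suc k) u (suc l) v
    (zsupported-zcons-any (suc k) _ (zheight≤-x k))
    (zsupported-zcons-any (suc l) _ (zheight≤-x l))
    (zsupported-zcons-any _ _ (zheight≤-x _))
nharmZ-height {q = suc q} (zheight0-x {k} {u}) (zheightS {ks = v} hb) =
  zsupported-nharmZ (suc k) u 0 v
    (zsupported-zcons-any (suc k) _ (zheight≤-x k))
    (zsupported-zcons 0 (nharmZ (suc k ∷ u) v) (zsupported-mono zheight≤-0∷ _ (nharmZ-height (zheight0-x {k} {u}) hb)))
    (zsupported-zcons-any _ _ (zheight≤-x _))
nharmZ-height {suc p} (zheightS {ks = u} ha) (zheight0-x {l} {v}) =
  zsupported-nharmZ 0 u (suc l) v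
    (zsupported-zcons 0 (nharmZ u (suc l ∷ v)) (zsupported-mono zheight≤-0∷ _ (nharmZ-height ha (zheight0-x {l} {v}))))
    (zsupported-zcons-any (suc l) _ (zheight≤-x l))
    (zsupported-zcons-any _ _ (zheight≤-x _))
nharmZ-height {suc p} {suc q} (zheightS {ks = u} ha) (zheightS {ks = v} hb) =
  zsupported-nharmZ 0 u 0 v
    (zsupported-zcons 0 (nharmZ u (0 ∷ v)) (zsupported-mono zheight≤-0∷ _ (nharmZ-height ha (zheightS hb))))
    (zsupported-zcons 0 (nharmZ (0 ∷ u) v)
      (zsupported-mono (λ {w} h → subst (λ n → ZHeight≤ (suc n) (0 ∷ w)) (sym (ℕP.+-suc p q)) (zheight≤-0∷ h)) _ (nharmZ-height (zheightS ha) hb)))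
    (zsupported-zcons-any _ _ (zheight≤-x _))

nharmZ-times-y : ∀ {j a} → ZHeight j a →
  ZSupported (λ v → v ≡ 0 ∷ a ⊎ ZHeight≤ j v) (nharmZ a (0 ∷ [])) × zcoeff (nharmZ a (0 ∷ [])) (0 ∷ a) ≡ natℚ (suc j)
nharmZ-times-y zheight0-empty = inj₂ (inj₁ refl) ∷ [] , refl
nharmZ-times-y (zheight0-x {k} {ks}) =
  zsupported-nharmZ (suc k) ks 0 []
    (zsupported-zcons-any (suc k) _ (λ v → inj₂ (zheight≤-x k v)))
    (inj₂ (inj₁ refl) ∷ [])
    (zsupported-zcons-any _ _ (λ v → inj₂ (zheight≤-x _ v))) ,
  trans (zcoeff-nharmZ (suc k) ks 0 [] (0 ∷ suc k ∷ ks)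
           (zcoeff-zcons-≢ (nharmZ ks (0 ∷ [])) (suc k ∷ ks) (λ ()))
           (trans (zcoeff-zcons 0 (nharmZ (suc k ∷ ks) []) (suc k ∷ ks)) (zcoeff-single (suc k ∷ ks)))
           (zcoeff-zcons-≢ (nharmZ ks []) (suc k ∷ ks) (λ ())))
        (solve 0 (con 0ℚ :+ (con 1ℚ :+ :- con 0ℚ) := con 1ℚ :+ con 0ℚ) refl)
nharmZ-times-y (zheightS {j} {ks} h) =
  zsupported-nharmZ 0 ks 0 []
    (zsupported-zcons 0 (nharmZ ks (0 ∷ [])) (zsupported-mono lift _ (proj₁ (nharmZ-times-y h))))
    (inj₂ (inj₁ refl) ∷ [])
    (zsupported-zcons-any _ _ (λ v → inj₂ (zheight≤-x _ v))) ,
  trans (zcoeff-nharmZ 0 ks 0 [] (0 ∷ 0 ∷ ks)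
           (trans (zcoeff-zcons 0 (nharmZ ks (0 ∷ [])) (0 ∷ ks)) (proj₂ (nharmZ-times-y h)))
           (trans (zcoeff-zcons 0 (nharmZ (0 ∷ ks) []) (0 ∷ ks)) (zcoeff-single (0 ∷ ks)))
           (zcoeff-zcons-≢ (nharmZ ks []) (0 ∷ ks) (λ ())))
        (solve 1 (λ n → n :+ (con 1ℚ :+ :- con 0ℚ) := con 1ℚ :+ n) refl (natℚ (suc j)))
  where
  lift : ∀ {v} → v ≡ 0 ∷ ks ⊎ ZHeight≤ j v → 0 ∷ v ≡ 0 ∷ 0 ∷ ks ⊎ ZHeight≤ (suc j) (0 ∷ v)
  lift (inj₁ refl) = inj₁ refl
  lift (inj₂ l) = inj₂ (zheight≤-0∷ l)

nharmZ-h0-times-Z^ : ∀ j {h} → ZHeight 0 h →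
  ZSupported (λ v → v ≡ Z^ j ++ h ⊎ ZHeight< j v) (nharmZ h (Z^ j)) × zcoeff (nharmZ h (Z^ j)) (Z^ j ++ h) ≡ 1ℚ
nharmZ-h0-times-Z^ j zheight0-empty =
  inj₂ (inj₁ (sym (++-identityʳ (Z^ j)))) ∷ [] ,
  subst (λ z → zcoeff ((1ℚ , Z^ j) ∷ []) z ≡ 1ℚ) (sym (++-identityʳ (Z^ j))) (zcoeff-single (Z^ j))
nharmZ-h0-times-Z^ zero (zheight0-x {k} {ks}) = inj₂ (inj₁ refl) ∷ [] , zcoeff-single (suc k ∷ ks)
nharmZ-h0-times-Z^ (suc j) (zheight0-x {k} {ks}) =
  zsupported-nharmZ (suc k) ks 0 (Z^ j)
    (zsupported-zcons-any (suc k) _ (λ v → inj₂ (0 , s≤s z≤n , zheight0-x)))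
    (zsupported-zcons 0 (nharmZ (suc k ∷ ks) (Z^ j)) (zsupported-mono lift _ (proj₁ IH)))
    (zsupported-zcons-any _ _ (λ v → inj₂ (0 , s≤s z≤n , zheight0-x))) ,
  trans (zcoeff-nharmZ (suc k) ks 0 (Z^ j) (0 ∷ (Z^ j ++ suc k ∷ ks))
           (zcoeff-zcons-≢ (nharmZ ks (0 ∷ Z^ j)) (Z^ j ++ suc k ∷ ks) (λ ()))
           (trans (zcoeff-zcons 0 (nharmZ (suc k ∷ ks) (Z^ j)) (Z^ j ++ suc k ∷ ks)) (proj₂ IH))
           (zcoeff-zcons-≢ (nharmZ ks (Z^ j)) (Z^ j ++ suc k ∷ ks) (λ ())))
        (solve 0 (con 0ℚ :+ (con 1ℚ :+ :- con 0ℚ) := con 1ℚ) refl)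
  where
  IH : ZSupported (λ v → v ≡ Z^ j ++ suc k ∷ ks ⊎ ZHeight< j v) (nharmZ (suc k ∷ ks) (Z^ j)) ×
       zcoeff (nharmZ (suc k ∷ ks) (Z^ j)) (Z^ j ++ suc k ∷ ks) ≡ 1ℚ
  IH = nharmZ-h0-times-Z^ j (zheight0-x {k} {ks})
  lift : ∀ {v} → v ≡ Z^ j ++ suc k ∷ ks ⊎ ZHeight< j v → 0 ∷ v ≡ 0 ∷ (Z^ j ++ suc k ∷ ks) ⊎ ZHeight< (suc j) (0 ∷ v)
  lift (inj₁ refl) = inj₁ refl
  lift (inj₂ (i , i<j , hi)) = inj₂ (suc i , s≤s i<j , zheightS hi)

endsInY-block : ∀ k r → (r ≡ [] ⊎ EndsInY r) → EndsInY (replicate k x ++ y ∷ r)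
endsInY-block zero r (inj₁ refl) = just-y
endsInY-block zero r (inj₂ e) = extend y e
endsInY-block (suc k) r h = extend x (endsInY-block k r h)

fromZ-endsInY : ∀ zs → fromZ zs ≡ [] ⊎ EndsInY (fromZ zs)
fromZ-endsInY [] = inj₁ refl
fromZ-endsInY (k ∷ ks) = inj₂ (endsInY-block k (fromZ ks) (fromZ-endsInY ks))

fromZ-height : ∀ {j zs} → ZHeight j zs → Height j (fromZ zs)
fromZ-height zheight0-empty = height0 h0-empty
fromZ-height (zheight0-x {k} {ks}) = height0 (h0-x (endsInY-block k (fromZ ks) (fromZ-endsInY ks)))
fromZ-height (zheightS h) = heightS (fromZ-height h)

block-injective : ∀ k l r s → replicate k x ++ y ∷ r ≡ replicate l x ++ y ∷ s → k ≡ l × r ≡ s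
block-injective zero zero r s e = refl , ∷-injectiveʳ e
block-injective zero (suc l) r s ()
block-injective (suc k) zero r s ()
block-injective (suc k) (suc l) r s e with block-injective k l r s (∷-injectiveʳ e)
... | refl , r≡s = refl , r≡s

fromZ-injective : ∀ a b → fromZ a ≡ fromZ b → a ≡ b
fromZ-injective [] [] e = refl
fromZ-injective [] (zero ∷ b) ()
fromZ-injective [] (suc l ∷ b) ()
fromZ-injective (zero ∷ a) [] ()
fromZ-injective (suc k ∷ a) [] ()
fromZ-injective (k ∷ a) (l ∷ b) e with block-injective k l (fromZ a) (fromZ b) e
... | refl , a≡b = cong (k ∷_) (fromZ-injective a b a≡b)

coeff-fromZ : ∀ zp t → coeff (fromZPoly zp) (fromZ t) ≡ zcoeff zp t
coeff-fromZ [] t = refl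
coeff-fromZ ((c , v) ∷ zp) t =
  trans (coeff-cons c (fromZ v) (fromZPoly zp) (fromZ t)) (cong₂ _+_ (by-cases (≡-dec ℕP._≟_ v t)) (coeff-fromZ zp t))
  where
  by-cases : Dec (v ≡ t) → c * indicator (fromZ t) (fromZ v) ≡ zterm t (c , v)
  by-cases (yes refl) = trans (cong (c *_) (indicator-≡ (fromZ v))) (trans (ℚP.*-identityʳ c) (sym (zterm-≡ c v)))
  by-cases (no v≢t) = trans (cong (c *_) (indicator-≢ (λ e → v≢t (fromZ-injective v t e))))
                            (trans (ℚP.*-zeroʳ c) (sym (zterm-≢ c v≢t)))

zsupported→supported : ∀ {P : ZWord → Set} {Q : Word → Set} → (∀ {zs} → P zs → Q (fromZ zs)) →
  ∀ zp → ZSupported P zp → Supported Q (fromZPoly zp)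
zsupported→supported f [] [] = []
zsupported→supported f (e ∷ zp) (inj₁ c≡0 ∷ sp) = inj₁ c≡0 ∷ zsupported→supported f zp sp
zsupported→supported f (e ∷ zp) (inj₂ Pv ∷ sp) = inj₂ (f Pv) ∷ zsupported→supported f zp sp

endsInY-toZ : ∀ {w} → EndsInY w → Σ ℕ λ k → Σ ZWord λ ks → toZ w ≡ k ∷ ks × fromZ (k ∷ ks) ≡ w
endsInY-toZ just-y = 0 , [] , refl , refl
endsInY-toZ (extend y e) with endsInY-toZ e
... | k , ks , e1 , e2 = 0 , k ∷ ks , cong (0 ∷_) e1 , cong (y ∷_) e2
endsInY-toZ (extend x e) with endsInY-toZ e
... | k , ks , e1 , e2 rewrite e1 = suc k , ks , refl , cong (x ∷_) e2

toZ-height : ∀ {j w} → Height j w → ZHeight j (toZ w) × fromZ (toZ w) ≡ w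
toZ-height (height0 h0-empty) = zheight0-empty , refl
toZ-height (height0 (h0-x e)) with endsInY-toZ e
... | k , ks , e1 , e2 rewrite e1 = zheight0-x , cong (x ∷_) e2
toZ-height (heightS h) = zheightS (proj₁ (toZ-height h)) , cong (y ∷_) (proj₂ (toZ-height h))

toZ-Y^ : ∀ j → toZ (Y^ j) ≡ Z^ j
toZ-Y^ zero = refl
toZ-Y^ (suc j) = cong (0 ∷_) (toZ-Y^ j)

fromZ-Z^ : ∀ j zs → fromZ (Z^ j ++ zs) ≡ Y^ j ++ fromZ zs
fromZ-Z^ zero zs = refl
fromZ-Z^ (suc j) zs = cong (y ∷_) (fromZ-Z^ j zs)

zheight≤→height≤ : ∀ {k zs} → ZHeight≤ k zs → Height≤ k (fromZ zs)
zheight≤→height≤ (j , j≤k , h) = j , j≤k , fromZ-height h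

zheight<→height< : ∀ {k zs} → ZHeight< k zs → Height< k (fromZ zs)
zheight<→height< (j , j<k , h) = j , j<k , fromZ-height h

nharm-times-y : ∀ {j a} → Height j a →
  Supported (λ v → v ≡ y ∷ a ⊎ Height≤ j v) (nharm a (y ∷ [])) × coeff (nharm a (y ∷ [])) (y ∷ a) ≡ natℚ (suc j)
nharm-times-y {j} {a} h =
  zsupported→supported lift (nharmZ (toZ a) (0 ∷ [])) (proj₁ (nharmZ-times-y zh)) ,
  trans (cong (coeff (nharm a (y ∷ []))) (cong (y ∷_) (sym a≡)))
        (trans (coeff-fromZ (nharmZ (toZ a) (0 ∷ [])) (0 ∷ toZ a)) (proj₂ (nharmZ-times-y zh)))
  where
  zh : ZHeight j (toZ a)
  zh = proj₁ (toZ-height h)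
  a≡ : fromZ (toZ a) ≡ a
  a≡ = proj₂ (toZ-height h)
  lift : ∀ {zs} → zs ≡ 0 ∷ toZ a ⊎ ZHeight≤ j zs → fromZ zs ≡ y ∷ a ⊎ Height≤ j (fromZ zs)
  lift (inj₁ refl) = inj₁ (cong (y ∷_) a≡)
  lift (inj₂ l) = inj₂ (zheight≤→height≤ l)

-- stated for any encoding zs of y^j, since toZ (Y^ j) is Z^ j only propositionally
nharm-h0-times-Y^ : ∀ j {h} zs → zs ≡ Z^ j → H0 h →
  Supported (λ v → v ≡ Y^ j ++ h ⊎ Height< j v) (fromZPoly (nharmZ (toZ h) zs)) ×
  coeff (fromZPoly (nharmZ (toZ h) zs)) (Y^ j ++ h) ≡ 1ℚ
nharm-h0-times-Y^ j {h} _ refl hh =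
  zsupported→supported lift (nharmZ (toZ h) (Z^ j)) (proj₁ (nharmZ-h0-times-Z^ j zh)) ,
  trans (cong (coeff (fromZPoly (nharmZ (toZ h) (Z^ j)))) (trans (cong (Y^ j ++_) (sym h≡)) (sym (fromZ-Z^ j (toZ h)))))
        (trans (coeff-fromZ (nharmZ (toZ h) (Z^ j)) (Z^ j ++ toZ h)) (proj₂ (nharmZ-h0-times-Z^ j zh)))
  where
  zh : ZHeight 0 (toZ h)
  zh = proj₁ (toZ-height (height0 hh))
  h≡ : fromZ (toZ h) ≡ h
  h≡ = proj₂ (toZ-height (height0 hh))
  lift : ∀ {zs} → zs ≡ Z^ j ++ toZ h ⊎ ZHeight< j zs → fromZ zs ≡ Y^ j ++ h ⊎ Height< j (fromZ zs)
  lift (inj₁ refl) = inj₁ (trans (fromZ-Z^ j (toZ h)) (cong (Y^ j ++_) h≡))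
  lift (inj₂ l) = inj₂ (zheight<→height< l)

harmonic-triangular : Triangular harmonic
harmonic-triangular = record
  { times-y = nharm-times-y
  ; h0-times-Y^ = λ j hh → nharm-h0-times-Y^ j _ (toZ-Y^ j) hh
  ; h0-times-height = λ {j} {h} {b} hh hb →
      zsupported→supported zheight≤→height≤ (nharmZ (toZ h) (toZ b))
        (nharmZ-height (proj₁ (toZ-height (height0 hh))) (proj₁ (toZ-height hb)))
  }

triangular : ∀ ch → Triangular ch
triangular harmonic = harmonic-triangular
triangular shuffle = shuffle-triangular

lemma2p10 : (ch : Choice) (m : ℕ) (w : Word) → IsH0Word w →
    Σ (Vec Poly (suc m)) λ ws →
      AllH0 ws ×
      word (replicate m y ++ w) ≈ expansion ch ws ×
      ((ws′ : Vec Poly (suc m)) → AllH0 ws′ →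
        word (replicate m y ++ w) ≈ expansion ch ws′ →
        (i : Fin (suc m)) → lookup ws′ i ≈ lookup ws i)
lemma2p10 ch m w hw = ws , hws , ws-expands , unique
  where
  open Expansion ch (triangular ch)
  existence : HasExpansion m (word (replicate m y ++ w))
  existence = word-hasExpansion m (m , ℕP.≤-refl , height-Y^ m (IsH0Word→H0 hw))
  ws : Vec Poly (suc m)
  ws = proj₁ existence
  hws : AllH0 ws
  hws = proj₁ (proj₂ existence)
  ws-expands : word (replicate m y ++ w) ≈ expansion ch ws
  ws-expands = proj₂ (proj₂ existence)
  unique : (ws′ : Vec Poly (suc m)) → AllH0 ws′ → word (replicate m y ++ w) ≈ expansion ch ws′ →
    (i : Fin (suc m)) → lookup ws′ i ≈ lookup ws i
  unique ws′ hws′ ws′-expands = expansion-unique ws ws′ hws hws′ (λ t → trans (sym (ws-expands t)) (ws′-expands t))
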